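{- Let $r\geq t\geq 3$ be integers, let $n_1\geq n_2\geq\cdots\geq n_r\geq 1$, and let $\mathcal{V}=(V_1,\ldots,V_r)$ be a partition of a set $V$ with $|V_i|=n_i$ for $i\in[r]$. A partition $\mathcal{P}=(P_1,\ldots,P_{t-1})$ of $V$ into $t-1$ classes is an extremal $(t-1)$-partition for $\mathcal{V}$ if and only if both of the following hold: (i) $\mathcal{P}$ is stable to $\mathcal{V}$; (ii) the internalization $I(\mathcal{P})$ is also an extremal $(t-1)$-partition for $\mathcal{V}$.
   Context: $K_{n_1,\ldots,n_r}$ denotes the complete $r$-partite graph on $V$ with parts $V_1,\ldots,V_r$. For $I\subseteq[r]$ let $n_I=\sum_{i\in I}n_i$. Define $f(n_1,\ldots,n_r,1,t)=\max_{\mathcal{Q}}\sum n_I n_{I'}$, where the maximum is over all partitions $\mathcal{Q}$ of $[r]$ into $t-1$ parts and the sum is over unordered pairs $\{I,I'\}$ of distinct parts of $\mathcal{Q}$. For a partition $\mathcal{P}=(P_1,\ldots,P_{t-1})$ of $V$, $K_{n_1,\ldots,n_r}[\mathcal{P}]$ is the spanning subgraph of $K_{n_1,\ldots,n_r}$ consisting of the edges $xy$ with $x,y$ in different classes of $\mathcal{P}$ (and, being edges of $K_{n_1,\ldots,n_r}$, in different classes of $\mathcal{V}$). $\mathcal{P}$ is an extremal $(t-1)$-partition for $\mathcal{V}$ if $e(K_{n_1,\ldots,n_r}[\mathcal{P}])=f(n_1,\ldots,n_r,1,t)$. $V_i$ is integral in $P_j$ if $V_i\subseteq P_j$, and partial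 in $P_j$ if $V_i\cap P_j\neq\emptyset$ and $V_i\not\subseteq P_j$; $V_i$ is a partial class of $\mathcal{V}$ if it is partial in some $P_j$. The integral part of $P_j$ is the union of the $V_i$ integral in $P_j$; the partial part of $P_j$ is the union of the sets $V_i\cap P_j$ over the $V_i$ partial in $P_j$. $P_j$ is a partial class of $\mathcal{P}$ if its partial part is nonempty, and an integral class otherwise. $\mathcal{P}$ is 1-partial to $\mathcal{V}$ if each $P_j$ has at most one $V_i$ partial in it. $\mathcal{P}$ is stable to $\mathcal{V}$ if: (1) $\mathcal{P}$ is 1-partial to $\mathcal{V}$; (2) the integral parts of all partial classes of $\mathcal{P}$ have the same size, and this size is at most the size of every integral class of $\mathcal{P}$; (3) the size of the integral part of every class of $\mathcal{P}$ is at least the size of every partial class $V_i$ of $\mathcal{V}$; (4) for every $j$ and every $V_i$ integral in $P_j$, $|P_j\setminus V_i|$ is at most the size of the integral part of every other class $P_{j'}$, $j'\neq j$. The internalization $I(\mathcal{P})$ is the partition obtained from $\mathcal{P}$ by moving, for each partial $V_i$, all vertices of $V_i$ into one class $P_j$ containing some vertices of $V_i$. -}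

module Defs where

open import Data.Nat using (ℕ; zero; suc; _+_; _*_; _≤_)
open import Data.Fin using (Fin; zero; suc)
open import Data.Fin.Properties using (_≟_; _<?_; all?; any?)
open import Data.Product using (Σ; ∃; _×_; _,_)
open import Data.Bool using (Bool; true; false; if_then_else_)
open import Relation.Nullary using (¬_; Dec; yes; no)
open import Relation.Nullary.Decidable using (⌊_⌋; _×-dec_; _→-dec_; ¬?)
open import Relation.Binary.PropositionalEquality using (_≡_; _≢_)

∑ : (n : ℕ) → (Fin n → ℕ) → ℕ
∑ zero f = 0
∑ (suc n) f = f zero + ∑ n (λ i → f (suc i))

count : {n : ℕ} {A : Fin n → Set} → ((x : Fin n) → Dec (A x)) → ℕ
count {n} d = ∑ n (λ x → if ⌊ d x ⌋ then 1 else 0)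

-- The extremal function f(n_1,...,n_r,1,t), k = t-1.
-- A partition Q of [r] into k labelled parts is a map Fin r → Fin k.

partSize : {r k : ℕ} → (Fin r → ℕ) → (Fin r → Fin k) → Fin k → ℕ
partSize {r} n Q j = ∑ r (λ i → if ⌊ Q i ≟ j ⌋ then n i else 0)

pairValue : {r k : ℕ} → (Fin r → ℕ) → (Fin r → Fin k) → ℕ
pairValue {r} {k} n Q =
  ∑ k (λ j → ∑ k (λ j' → if ⌊ j <? j' ⌋ then partSize n Q j * partSize n Q j' else 0))

IsF : (r k : ℕ) → (Fin r → ℕ) → ℕ → Set
IsF r k n m = (∃ λ (Q : Fin r → Fin k) → pairValue n Q ≡ m)
            × ((Q : Fin r → Fin k) → pairValue n Q ≤ m)

-- Vertex set V = Fin N, the partition 𝒱 given by the class map c : Fin N → Fin r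
-- (V_i = c⁻¹(i)), a partition 𝒫 of V into k classes by P : Fin N → Fin k
-- (P_j = P⁻¹(j)).

-- e(K_{n_1..n_r}[𝒫]): unordered pairs {x,y} in different 𝒱-classes and different 𝒫-classes
edgesP : {N r k : ℕ} → (Fin N → Fin r) → (Fin N → Fin k) → ℕ
edgesP {N} c P =
  ∑ N (λ x → ∑ N (λ y →
    if ⌊ (x <? y) ×-dec (¬? (c x ≟ c y) ×-dec ¬? (P x ≟ P y)) ⌋ then 1 else 0))

Extremal : {N r k : ℕ} → (Fin r → ℕ) → (Fin N → Fin r) → (Fin N → Fin k) → Set
Extremal {N} {r} {k} n c P = IsF r k n (edgesP c P)

module _ {N r k : ℕ} (c : Fin N → Fin r) (P : Fin N → Fin k) where

  Integral : Fin r → Fin k → Set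
  Integral i j = (x : Fin N) → c x ≡ i → P x ≡ j

  integral? : (i : Fin r) (j : Fin k) → Dec (Integral i j)
  integral? i j = all? (λ x → (c x ≟ i) →-dec (P x ≟ j))

  Meets : Fin r → Fin k → Set
  Meets i j = ∃ λ (x : Fin N) → c x ≡ i × P x ≡ j

  PartialIn : Fin r → Fin k → Set
  PartialIn i j = Meets i j × ¬ Integral i j

  PartialV : Fin r → Set
  PartialV i = ∃ λ (j : Fin k) → PartialIn i j

  PartialP : Fin k → Set
  PartialP j = ∃ λ (i : Fin r) → PartialIn i j

  classSize : Fin k → ℕ
  classSize j = count (λ x → P x ≟ j)

  intSize : Fin k → ℕ
  intSize j = count (λ x → (P x ≟ j) ×-dec integral? (c x) j)

  diffSize : Fin k → Fin r → ℕ
  diffSize j i = count (λ x → (P x ≟ j) ×-dec ¬? (c x ≟ i))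

  OnePartial : Set
  OnePartial = (j : Fin k) (i i' : Fin r) → PartialIn i j → PartialIn i' j → i ≡ i'

  module _ (n : Fin r → ℕ) where

    Stable : Set
    Stable =
      -- (1)
      OnePartial
      -- (2) integral parts of partial classes have equal size ...
      × ((j j' : Fin k) → PartialP j → PartialP j' → intSize j ≡ intSize j')
      × ((j j' : Fin k) → PartialP j → ¬ PartialP j' → intSize j ≤ classSize j')
      -- (3)
      × ((j : Fin k) (i : Fin r) → PartialV i → n i ≤ intSize j)
      -- (4)
      × ((j : Fin k) (i : Fin r) → Integral i j →
           (j' : Fin k) → j ≢ j' → diffSize j i ≤ intSize j')

  IsInternalization : (Fin N → Fin k) → Set
  IsInternalization Q = ∃ λ (g : Fin r → Fin k) →
      ((i : Fin r) → PartialV i → Meets i (g i))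
    × ((x : Fin N) → (PartialV (c x) → Q x ≡ g (c x))
                   × (¬ PartialV (c x) → Q x ≡ P x))

-- Record a partition 𝒫 by its intersection matrix b i j = |V_i ∩ P_j|, whose row sums are the n_i. Twice the
-- number of edges of K[𝒫] is a function S of b that is affine in each row, the coefficient of b i j being the
-- number of vertices outside V_i ∪ P_j, i.e. Σ_{a≠i} n_a − |P_j ∖ V_i|. Over all matrices with these row sums,
-- concentrating a row where its coefficient is largest never lowers S, so partitions of [r] attain the maximum
-- and 𝒫 is extremal iff b maximises S. In a maximiser, |P_j ∖ V_i| is minimal, hence constant, on the classes
-- met by V_i; since shifting vertices of V_i between such classes, or moving all of V_i into one of them, keeps
-- a maximiser, comparing these minimality conditions before and after such moves gives (1)–(4) and shows that
-- internalising preserves S. Conversely, under (1) and (2) a partial V_i has |P_j ∖ V_i| equal to the common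
-- size of the integral parts on every class it meets, so internalising one V_i at a time again preserves S.

module Submission where

open import Defs
open import Data.Nat using (ℕ; zero; suc; _+_; _*_; _∸_; _≤_; _<_; z≤n; s≤s; _≤?_)
open import Data.Nat.Properties hiding (_≟_; _<?_; <-cmp; <-asym)
import Data.Nat.Properties as ℕ
open import Data.Fin using (Fin; zero; suc; toℕ; fromℕ<) renaming (_≤_ to _≤ᶠ_)
open import Data.Fin.Properties
  using (_≟_; _<?_; <-cmp; <-asym; any?; pigeonhole; toℕ-fromℕ<; toℕ-injective; toℕ<n)
  renaming (<⇒≢ to <ᶠ⇒≢)
open import Data.Bool using (Bool; true; false; if_then_else_)
open import Data.Product using (∃; _×_; _,_; proj₁; proj₂)
open import Data.Sum using (_⊎_; inj₁; inj₂)
open import Data.Empty using (⊥-elim)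
open import Relation.Nullary using (¬_; Dec; yes; no)
open import Relation.Nullary.Decidable using (⌊_⌋; _×-dec_; ¬?)
open import Relation.Binary.Definitions using (tri<; tri≈; tri>)
open import Relation.Binary.PropositionalEquality
open import Function.Bundles using (_⇔_; mk⇔)
open import Data.List.Base using (allFin)
open import Data.List.Extrema.Nat using (argmax; f[xs]≤f[argmax])
open import Data.List.Relation.Unary.All using (lookup)
open import Data.List.Membership.Propositional.Properties using (∈-allFin)
open import Algebra.Properties.Semiring.Sum +-*-semiring
  using (sum; ∑-distrib-+; ∑-comm; *-distribˡ-sum)
open import Algebra.Properties.CommutativeSemigroup +-commutativeSemigroup using (xy∙z≈xz∙y)


-- Finite sums

onlyIf : Bool → ℕ → ℕ
onlyIf b x = if b then x else 0

unless : Bool → ℕ → ℕ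
unless b x = if b then 0 else x

onlyIf-yes : ∀ {p} {A : Set p} (d : Dec A) {x : ℕ} → A → onlyIf ⌊ d ⌋ x ≡ x
onlyIf-yes (yes _) a = refl
onlyIf-yes (no ¬a) a = ⊥-elim (¬a a)

onlyIf-no : ∀ {p} {A : Set p} (d : Dec A) {x : ℕ} → ¬ A → onlyIf ⌊ d ⌋ x ≡ 0
onlyIf-no (yes a) ¬a = ⊥-elim (¬a a)
onlyIf-no (no _) ¬a = refl

unless-yes : ∀ {p} {A : Set p} (d : Dec A) {x : ℕ} → A → unless ⌊ d ⌋ x ≡ 0
unless-yes (yes _) a = refl
unless-yes (no ¬a) a = ⊥-elim (¬a a)

unless-no : ∀ {p} {A : Set p} (d : Dec A) {x : ℕ} → ¬ A → unless ⌊ d ⌋ x ≡ x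
unless-no (yes a) ¬a = ⊥-elim (¬a a)
unless-no (no _) ¬a = refl

onlyIf-zero : ∀ b → onlyIf b 0 ≡ 0
onlyIf-zero true = refl
onlyIf-zero false = refl

unless-zero : ∀ b → unless b 0 ≡ 0
unless-zero true = refl
unless-zero false = refl

onlyIf-*ˡ : ∀ b x y → onlyIf b x * y ≡ onlyIf b (x * y)
onlyIf-*ˡ true x y = refl
onlyIf-*ˡ false x y = refl

unless-+ : ∀ b x y → unless b (x + y) ≡ unless b x + unless b y
unless-+ true x y = refl
unless-+ false x y = refl

unless-*ʳ : ∀ b x y → unless b (x * y) ≡ x * unless b y
unless-*ʳ true x y = sym (*-zeroʳ x)
unless-*ʳ false x y = refl

≟-sym : ∀ {n} (a b : Fin n) → ⌊ a ≟ b ⌋ ≡ ⌊ b ≟ a ⌋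
≟-sym a b with a ≟ b | b ≟ a
... | yes _ | yes _ = refl
... | no _ | no _ = refl
... | yes p | no q = ⊥-elim (q (sym p))
... | no p | yes q = ⊥-elim (p (sym q))

≟-refl : ∀ {n} (a : Fin n) → ⌊ a ≟ a ⌋ ≡ true
≟-refl a with a ≟ a
... | yes _ = refl
... | no p = ⊥-elim (p refl)

zero-or-pos : ∀ x → x ≡ 0 ⊎ 1 ≤ x
zero-or-pos zero = inj₁ refl
zero-or-pos (suc x) = inj₂ (s≤s z≤n)

∑≡sum : ∀ n (f : Fin n → ℕ) → ∑ n f ≡ sum f
∑≡sum zero f = refl
∑≡sum (suc n) f = cong (f zero +_) (∑≡sum n (λ i → f (suc i)))

∑-cong : ∀ n {f g : Fin n → ℕ} → (∀ i → f i ≡ g i) → ∑ n f ≡ ∑ n g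
∑-cong zero h = refl
∑-cong (suc n) h = cong₂ _+_ (h zero) (∑-cong n (λ i → h (suc i)))

∑-zero : ∀ n {f : Fin n → ℕ} → (∀ i → f i ≡ 0) → ∑ n f ≡ 0
∑-zero zero h = refl
∑-zero (suc n) h = cong₂ _+_ (h zero) (∑-zero n (λ i → h (suc i)))

unless-∑ : ∀ b n (f : Fin n → ℕ) → unless b (∑ n f) ≡ ∑ n (λ i → unless b (f i))
unless-∑ true n f = sym (∑-zero n (λ _ → refl))
unless-∑ false n f = refl

onlyIf-∑ : ∀ b n (f : Fin n → ℕ) → onlyIf b (∑ n f) ≡ ∑ n (λ i → onlyIf b (f i))
onlyIf-∑ true n f = refl
onlyIf-∑ false n f = sym (∑-zero n (λ _ → refl))

∑-+ : ∀ n (f g : Fin n → ℕ) → ∑ n (λ i → f i + g i) ≡ ∑ n f + ∑ n g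
∑-+ n f g = begin
  ∑ n (λ i → f i + g i) ≡⟨ ∑≡sum n _ ⟩
  sum (λ i → f i + g i) ≡⟨ ∑-distrib-+ f g ⟩
  sum f + sum g         ≡⟨ sym (cong₂ _+_ (∑≡sum n f) (∑≡sum n g)) ⟩
  ∑ n f + ∑ n g         ∎
  where open ≡-Reasoning

∑-swap : ∀ n m (f : Fin n → Fin m → ℕ) →
  ∑ n (λ i → ∑ m (λ j → f i j)) ≡ ∑ m (λ j → ∑ n (λ i → f i j))
∑-swap n m f = begin
  ∑ n (λ i → ∑ m (f i))                ≡⟨ trans (∑-cong n (λ i → ∑≡sum m (f i))) (∑≡sum n _) ⟩
  sum (λ i → sum (f i))                ≡⟨ ∑-comm f ⟩
  sum (λ j → sum (λ i → f i j))        ≡⟨ sym (trans (∑-cong m (λ j → ∑≡sum n _)) (∑≡sum m _)) ⟩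
  ∑ m (λ j → ∑ n (λ i → f i j))        ∎
  where open ≡-Reasoning

∑-*ˡ : ∀ n x (f : Fin n → ℕ) → ∑ n (λ i → x * f i) ≡ x * ∑ n f
∑-*ˡ n x f = begin
  ∑ n (λ i → x * f i) ≡⟨ ∑≡sum n _ ⟩
  sum (λ i → x * f i) ≡⟨ sym (*-distribˡ-sum x f) ⟩
  x * sum f           ≡⟨ cong (x *_) (sym (∑≡sum n f)) ⟩
  x * ∑ n f           ∎
  where open ≡-Reasoning

∑-*ʳ : ∀ n x (f : Fin n → ℕ) → ∑ n (λ i → f i * x) ≡ ∑ n f * x
∑-*ʳ n x f = trans (∑-cong n (λ i → *-comm (f i) x)) (trans (∑-*ˡ n x f) (*-comm x _))

∑-mono-≤ : ∀ n {f g : Fin n → ℕ} → (∀ i → f i ≤ g i) → ∑ n f ≤ ∑ n g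
∑-mono-≤ zero h = z≤n
∑-mono-≤ (suc n) h = +-mono-≤ (h zero) (∑-mono-≤ n (λ i → h (suc i)))

term≤∑ : ∀ n (f : Fin n → ℕ) (i : Fin n) → f i ≤ ∑ n f
term≤∑ (suc n) f zero = m≤m+n _ _
term≤∑ (suc n) f (suc i) = ≤-trans (term≤∑ n _ i) (m≤n+m _ _)

∑-positive : ∀ n (f : Fin n → ℕ) → 1 ≤ ∑ n f → ∃ λ i → 1 ≤ f i
∑-positive (suc n) f h with zero-or-pos (f zero)
... | inj₂ p = zero , p
... | inj₁ e with ∑-positive n (λ i → f (suc i)) (subst (λ z → 1 ≤ z + ∑ n (λ i → f (suc i))) e h)
... | i , p = suc i , p

≟-suc : ∀ {n} (i j : Fin n) → ⌊ suc i ≟ suc j ⌋ ≡ ⌊ i ≟ j ⌋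
≟-suc i j with i ≟ j
... | yes _ = refl
... | no _ = refl

∑-onlyIf≟ : ∀ n (j : Fin n) (f : Fin n → ℕ) → ∑ n (λ i → onlyIf ⌊ i ≟ j ⌋ (f i)) ≡ f j
∑-onlyIf≟ (suc n) zero f = trans (cong (f zero +_) (∑-zero n (λ i → refl))) (+-identityʳ _)
∑-onlyIf≟ (suc n) (suc j) f =
  trans (∑-cong n (λ i → cong (λ b → onlyIf b (f (suc i))) (≟-suc i j))) (∑-onlyIf≟ n j (λ i → f (suc i)))

∑-onlyIf≟ˡ : ∀ n (j : Fin n) (f : Fin n → ℕ) → ∑ n (λ i → onlyIf ⌊ j ≟ i ⌋ (f i)) ≡ f j
∑-onlyIf≟ˡ n j f = trans (∑-cong n (λ i → cong (λ b → onlyIf b (f i)) (≟-sym j i))) (∑-onlyIf≟ n j f)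

∑-split : ∀ n (j : Fin n) (f : Fin n → ℕ) → ∑ n f ≡ f j + ∑ n (λ i → unless ⌊ i ≟ j ⌋ (f i))
∑-split n j f = begin
  ∑ n f                                             ≡⟨ ∑-cong n pointwise ⟩
  ∑ n (λ i → onlyIf ⌊ i ≟ j ⌋ (f i) + unless ⌊ i ≟ j ⌋ (f i)) ≡⟨ ∑-+ n _ _ ⟩
  ∑ n (λ i → onlyIf ⌊ i ≟ j ⌋ (f i)) + ∑ n (λ i → unless ⌊ i ≟ j ⌋ (f i))
    ≡⟨ cong (_+ ∑ n (λ i → unless ⌊ i ≟ j ⌋ (f i))) (∑-onlyIf≟ n j f) ⟩
  f j + ∑ n (λ i → unless ⌊ i ≟ j ⌋ (f i))          ∎
  where
  open ≡-Reasoning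
  pointwise : ∀ i → f i ≡ onlyIf ⌊ i ≟ j ⌋ (f i) + unless ⌊ i ≟ j ⌋ (f i)
  pointwise i with i ≟ j
  ... | yes _ = sym (+-identityʳ _)
  ... | no _ = refl

∑-except-positive : ∀ n (j : Fin n) (f : Fin n → ℕ) → 1 ≤ ∑ n (λ i → unless ⌊ i ≟ j ⌋ (f i)) →
  ∃ λ i → ¬ i ≡ j × 1 ≤ f i
∑-except-positive n j f pos with ∑-positive n (λ i → unless ⌊ i ≟ j ⌋ (f i)) pos
... | i , p with i ≟ j
...   | yes _ = ⊥-elim (1+n≰n (≤-trans p z≤n))
...   | no i≢j = i , i≢j , p

-- Matrices and their cross weight

Matrix : ℕ → ℕ → Set
Matrix r k = Fin r → Fin k → ℕ

module _ {k : ℕ} where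

  across : (Fin k → ℕ) → (Fin k → ℕ) → ℕ
  across u v = ∑ k (λ j → ∑ k (λ j' → unless ⌊ j ≟ j' ⌋ (u j * v j')))

  across-comm : ∀ u v → across u v ≡ across v u
  across-comm u v = trans (∑-swap k k _) (∑-cong k (λ j → ∑-cong k (λ j' →
    cong₂ unless (≟-sym j' j) (*-comm (u j') (v j)))))

  across-cong : ∀ {u u' v v'} → (∀ j → u j ≡ u' j) → (∀ j → v j ≡ v' j) → across u v ≡ across u' v'
  across-cong hu hv = ∑-cong k (λ j → ∑-cong k (λ j' → cong (unless ⌊ j ≟ j' ⌋) (cong₂ _*_ (hu j) (hv j'))))

module _ {r k : ℕ} where

  -- For b a j = |V_a ∩ P_j| this counts ordered pairs of vertices separated by both 𝒱 and 𝒫: it is 2 e(K[𝒫]).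
  crossWeight : Matrix r k → ℕ
  crossWeight b = ∑ r (λ a → ∑ r (λ a' → unless ⌊ a ≟ a' ⌋ (across (b a) (b a'))))

  crossWeight-cong : ∀ {b b' : Matrix r k} → (∀ a j → b a j ≡ b' a j) → crossWeight b ≡ crossWeight b'
  crossWeight-cong h = ∑-cong r (λ a → ∑-cong r (λ a' → cong (unless ⌊ a ≟ a' ⌋) (across-cong (h a) (h a'))))

  -- For b = (|V_a ∩ P_j|), outside b i j counts the neighbours in K[𝒫] of a vertex of V_i ∩ P_j.
  outside : Matrix r k → Fin r → Fin k → ℕ
  outside b i j = ∑ r (λ a → unless ⌊ a ≟ i ⌋ (∑ k (λ j' → unless ⌊ j ≟ j' ⌋ (b a j'))))

  gain : Matrix r k → Fin r → (Fin k → ℕ) → ℕ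
  gain b i v = ∑ k (λ j → v j * outside b i j)

  crossWeightOff : Matrix r k → Fin r → ℕ
  crossWeightOff b i = ∑ r (λ a → unless ⌊ a ≟ i ⌋ (∑ r (λ a' →
    unless ⌊ a' ≟ i ⌋ (unless ⌊ a ≟ a' ⌋ (across (b a) (b a'))))))

  AgreeOff : Matrix r k → Matrix r k → Fin r → Set
  AgreeOff b b' i = ∀ a → ¬ a ≡ i → ∀ j → b a j ≡ b' a j

  outside-agreeOff : ∀ {b b' : Matrix r k} {i} → AgreeOff b b' i → ∀ j → outside b i j ≡ outside b' i j
  outside-agreeOff {b} {b'} {i} h j = ∑-cong r rowTerm
    where
    rowTerm : ∀ a → unless ⌊ a ≟ i ⌋ (∑ k (λ j' → unless ⌊ j ≟ j' ⌋ (b a j')))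
                  ≡ unless ⌊ a ≟ i ⌋ (∑ k (λ j' → unless ⌊ j ≟ j' ⌋ (b' a j')))
    rowTerm a with a ≟ i
    ... | yes _ = refl
    ... | no a≢i = ∑-cong k (λ j' → cong (unless ⌊ j ≟ j' ⌋) (h a a≢i j'))

  crossWeightOff-agreeOff : ∀ {b b' : Matrix r k} {i} → AgreeOff b b' i → crossWeightOff b i ≡ crossWeightOff b' i
  crossWeightOff-agreeOff {b} {b'} {i} h = ∑-cong r rowTerm
    where
    pairTerm : ∀ a → ¬ a ≡ i → ∀ a' →
      unless ⌊ a' ≟ i ⌋ (unless ⌊ a ≟ a' ⌋ (across (b a) (b a')))
        ≡ unless ⌊ a' ≟ i ⌋ (unless ⌊ a ≟ a' ⌋ (across (b' a) (b' a')))
    pairTerm a a≢i a' with a' ≟ i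
    ... | yes _ = refl
    ... | no a'≢i = cong (unless ⌊ a ≟ a' ⌋) (across-cong (h a a≢i) (h a' a'≢i))
    rowTerm : ∀ a →
      unless ⌊ a ≟ i ⌋ (∑ r (λ a' → unless ⌊ a' ≟ i ⌋ (unless ⌊ a ≟ a' ⌋ (across (b a) (b a')))))
        ≡ unless ⌊ a ≟ i ⌋ (∑ r (λ a' → unless ⌊ a' ≟ i ⌋ (unless ⌊ a ≟ a' ⌋ (across (b' a) (b' a')))))
    rowTerm a with a ≟ i
    ... | yes _ = refl
    ... | no a≢i = ∑-cong r (pairTerm a a≢i)

  crossWeight-byRow : ∀ b i → crossWeight b ≡ crossWeightOff b i + 2 * gain b i (b i)
  crossWeight-byRow b i = begin
    crossWeight b                                ≡⟨ ∑-split r i rowSum ⟩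
    rowSum i + ∑ r (λ a → unless ⌊ a ≟ i ⌋ (rowSum a))
      ≡⟨ cong₂ _+_ rowSum-i (trans (∑-cong r rowSum-other) (∑-+ r _ _)) ⟩
    withRow + (withRow + crossWeightOff b i)     ≡⟨ double withRow (crossWeightOff b i) ⟩
    crossWeightOff b i + 2 * withRow             ≡⟨ cong (λ z → crossWeightOff b i + 2 * z) withRow-outside ⟩
    crossWeightOff b i + 2 * gain b i (b i)      ∎
    where
    open ≡-Reasoning
    rowSum : Fin r → ℕ
    rowSum a = ∑ r (λ a' → unless ⌊ a ≟ a' ⌋ (across (b a) (b a')))
    withRow : ℕ
    withRow = ∑ r (λ a → unless ⌊ a ≟ i ⌋ (across (b i) (b a)))
    rowSum-i : rowSum i ≡ withRow
    rowSum-i = ∑-cong r (λ a → cong (λ c → unless c (across (b i) (b a))) (≟-sym i a))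
    rowSum-other : ∀ a → unless ⌊ a ≟ i ⌋ (rowSum a)
      ≡ unless ⌊ a ≟ i ⌋ (across (b i) (b a))
        + unless ⌊ a ≟ i ⌋ (∑ r (λ a' → unless ⌊ a' ≟ i ⌋ (unless ⌊ a ≟ a' ⌋ (across (b a) (b a')))))
    rowSum-other a with a ≟ i
    ... | yes _ = refl
    ... | no a≢i = trans (∑-split r i _)
      (cong (_+ ∑ r (λ a' → unless ⌊ a' ≟ i ⌋ (unless ⌊ a ≟ a' ⌋ (across (b a) (b a')))))
            (trans (unless-no (a ≟ i) a≢i) (across-comm (b a) (b i))))
    withRow-term : ∀ a → unless ⌊ a ≟ i ⌋ (across (b i) (b a))
      ≡ ∑ k (λ j → b i j * unless ⌊ a ≟ i ⌋ (∑ k (λ j' → unless ⌊ j ≟ j' ⌋ (b a j'))))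
    withRow-term a = trans (unless-∑ ⌊ a ≟ i ⌋ k _) (∑-cong k (λ j →
      trans (cong (unless ⌊ a ≟ i ⌋)
                  (trans (∑-cong k (λ j' → unless-*ʳ ⌊ j ≟ j' ⌋ (b i j) (b a j'))) (∑-*ˡ k (b i j) _)))
            (unless-*ʳ ⌊ a ≟ i ⌋ (b i j) _)))
    withRow-outside : withRow ≡ gain b i (b i)
    withRow-outside = begin
      withRow ≡⟨ ∑-cong r withRow-term ⟩
      ∑ r (λ a → ∑ k (λ j → b i j * unless ⌊ a ≟ i ⌋ (∑ k (λ j' → unless ⌊ j ≟ j' ⌋ (b a j')))))
        ≡⟨ ∑-swap r k _ ⟩
      ∑ k (λ j → ∑ r (λ a → b i j * unless ⌊ a ≟ i ⌋ (∑ k (λ j' → unless ⌊ j ≟ j' ⌋ (b a j')))))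
        ≡⟨ ∑-cong k (λ j → ∑-*ˡ r (b i j) _) ⟩
      gain b i (b i) ∎
    double : ∀ x y → x + (x + y) ≡ y + 2 * x
    double x y = trans (sym (+-assoc x x y))
      (trans (+-comm (x + x) y) (cong (λ z → y + (x + z)) (sym (+-identityʳ x))))

setRow : ∀ {r k} → Matrix r k → Fin r → (Fin k → ℕ) → Matrix r k
setRow b i v a j = if ⌊ a ≟ i ⌋ then v j else b a j

module _ {r k : ℕ} where

  setRow-same : ∀ (b : Matrix r k) i v j → setRow b i v i j ≡ v j
  setRow-same b i v j with i ≟ i
  ... | yes _ = refl
  ... | no i≢i = ⊥-elim (i≢i refl)

  setRow-other : ∀ (b : Matrix r k) i v a → ¬ a ≡ i → ∀ j → setRow b i v a j ≡ b a j
  setRow-other b i v a a≢i j with a ≟ i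
  ... | yes a≡i = ⊥-elim (a≢i a≡i)
  ... | no _ = refl

  setRow-agreeOff : ∀ (b : Matrix r k) i v → AgreeOff b (setRow b i v) i
  setRow-agreeOff b i v a a≢i j = sym (setRow-other b i v a a≢i j)

  setRow-cong : ∀ (b : Matrix r k) i {v v'} → (∀ j → v j ≡ v' j) → ∀ a j → setRow b i v a j ≡ setRow b i v' a j
  setRow-cong b i h a j with a ≟ i
  ... | yes _ = h j
  ... | no _ = refl

  setRow-id : ∀ (b : Matrix r k) i {v} → (∀ j → v j ≡ b i j) → ∀ a j → setRow b i v a j ≡ b a j
  setRow-id b i h a j with a ≟ i
  ... | yes refl = h j
  ... | no _ = refl

  -- S is affine in row i, with coefficients 2 · outside b i.
  crossWeight-setRow : ∀ (b : Matrix r k) i v →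
    crossWeight (setRow b i v) + 2 * gain b i (b i) ≡ crossWeight b + 2 * gain b i v
  crossWeight-setRow b i v = begin
    crossWeight b' + 2 * gain b i (b i)
      ≡⟨ cong (_+ 2 * gain b i (b i)) (crossWeight-byRow b' i) ⟩
    crossWeightOff b' i + 2 * gain b' i (b' i) + 2 * gain b i (b i)
      ≡⟨ cong₂ (λ x y → x + 2 * y + 2 * gain b i (b i)) (sym (crossWeightOff-agreeOff agree))
           (∑-cong k (λ j → cong₂ _*_ (setRow-same b i v j) (sym (outside-agreeOff agree j)))) ⟩
    crossWeightOff b i + 2 * gain b i v + 2 * gain b i (b i)
      ≡⟨ xy∙z≈xz∙y (crossWeightOff b i) _ _ ⟩
    crossWeightOff b i + 2 * gain b i (b i) + 2 * gain b i v
      ≡⟨ cong (_+ 2 * gain b i v) (sym (crossWeight-byRow b i)) ⟩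
    crossWeight b + 2 * gain b i v ∎
    where
    open ≡-Reasoning
    b' = setRow b i v
    agree = setRow-agreeOff b i v

  gain≤⇒crossWeight≤ : ∀ (b : Matrix r k) i v → gain b i (b i) ≤ gain b i v →
    crossWeight b ≤ crossWeight (setRow b i v)
  gain≤⇒crossWeight≤ b i v le = +-cancelʳ-≤ (2 * gain b i (b i)) _ _
    (≤-trans (+-monoʳ-≤ (crossWeight b) (*-monoʳ-≤ 2 le)) (≤-reflexive (sym (crossWeight-setRow b i v))))

  sameGain⇒sameCrossWeight : ∀ (b : Matrix r k) i v → gain b i v ≡ gain b i (b i) →
    crossWeight (setRow b i v) ≡ crossWeight b
  sameGain⇒sameCrossWeight b i v same =
    +-cancelʳ-≡ _ _ _ (trans (crossWeight-setRow b i v) (cong (λ z → crossWeight b + 2 * z) same))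

  columnExcept : Matrix r k → Fin r → Fin k → ℕ
  columnExcept b i j = ∑ r (λ a → unless ⌊ a ≟ i ⌋ (b a j))

  column : Matrix r k → Fin k → ℕ
  column b j = ∑ r (λ a → b a j)

  columnExcept+entry : ∀ b i j → columnExcept b i j + b i j ≡ column b j
  columnExcept+entry b i j = trans (+-comm (columnExcept b i j) (b i j)) (sym (∑-split r i (λ a → b a j)))

  entry≤columnExcept : ∀ (b : Matrix r k) i a j → ¬ a ≡ i → b a j ≤ columnExcept b i j
  entry≤columnExcept b i a j a≢i =
    ≤-trans (≤-reflexive (sym (unless-no (a ≟ i) a≢i))) (term≤∑ r (λ a' → unless ⌊ a' ≟ i ⌋ (b a' j)) a)

  columnExcept-agreeOff : ∀ {b b' : Matrix r k} {i} → AgreeOff b b' i → ∀ j → columnExcept b i j ≡ columnExcept b' i j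
  columnExcept-agreeOff {b} {b'} {i} h j = ∑-cong r entry
    where
    entry : ∀ a → unless ⌊ a ≟ i ⌋ (b a j) ≡ unless ⌊ a ≟ i ⌋ (b' a j)
    entry a with a ≟ i
    ... | yes _ = refl
    ... | no a≢i = h a a≢i j

  column-setRow : ∀ (b : Matrix r k) i v x → column (setRow b i v) x ≡ columnExcept b i x + v x
  column-setRow b i v x = trans (sym (columnExcept+entry (setRow b i v) i x))
    (cong₂ _+_ (sym (columnExcept-agreeOff (setRow-agreeOff b i v) x)) (setRow-same b i v x))

  columnExcept-setRow : ∀ (b : Matrix r k) i v i' → ¬ i ≡ i' → ∀ x →
    columnExcept (setRow b i v) i' x + b i x ≡ columnExcept b i' x + v x
  columnExcept-setRow b i v i' i≢i' x = begin
    columnExcept (setRow b i v) i' x + b i x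
      ≡⟨ cong (columnExcept (setRow b i v) i' x +_) (sym (∑-onlyIf≟ r i (λ _ → b i x))) ⟩
    columnExcept (setRow b i v) i' x + ∑ r (λ a → onlyIf ⌊ a ≟ i ⌋ (b i x))
      ≡⟨ sym (∑-+ r _ _) ⟩
    ∑ r (λ a → unless ⌊ a ≟ i' ⌋ (setRow b i v a x) + onlyIf ⌊ a ≟ i ⌋ (b i x))
      ≡⟨ ∑-cong r entry ⟩
    ∑ r (λ a → unless ⌊ a ≟ i' ⌋ (b a x) + onlyIf ⌊ a ≟ i ⌋ (v x))
      ≡⟨ ∑-+ r _ _ ⟩
    columnExcept b i' x + ∑ r (λ a → onlyIf ⌊ a ≟ i ⌋ (v x))
      ≡⟨ cong (columnExcept b i' x +_) (∑-onlyIf≟ r i (λ _ → v x)) ⟩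
    columnExcept b i' x + v x ∎
    where
    open ≡-Reasoning
    entry : ∀ a → unless ⌊ a ≟ i' ⌋ (setRow b i v a x) + onlyIf ⌊ a ≟ i ⌋ (b i x)
                ≡ unless ⌊ a ≟ i' ⌋ (b a x) + onlyIf ⌊ a ≟ i ⌋ (v x)
    entry a with a ≟ i | a ≟ i'
    ... | yes refl | yes refl = ⊥-elim (i≢i' refl)
    ... | yes refl | no _ = +-comm _ (b a x)
    ... | no _ | yes _ = refl
    ... | no _ | no _ = refl

  columnExcept-setRow-loss : ∀ (b : Matrix r k) i v i' → ¬ i ≡ i' → ∀ x d → b i x ≡ v x + d →
    columnExcept (setRow b i v) i' x + d ≡ columnExcept b i' x
  columnExcept-setRow-loss b i v i' i≢i' x d b≡v+d = +-cancelʳ-≡ (v x) _ _ (begin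
    D' + d + v x   ≡⟨ +-assoc D' d (v x) ⟩
    D' + (d + v x) ≡⟨ cong (D' +_) (trans (+-comm d (v x)) (sym b≡v+d)) ⟩
    D' + b i x     ≡⟨ columnExcept-setRow b i v i' i≢i' x ⟩
    columnExcept b i' x + v x ∎)
    where
    open ≡-Reasoning
    D' = columnExcept (setRow b i v) i' x

  columnExcept-setRow-unchanged : ∀ (b : Matrix r k) i v i' → ¬ i ≡ i' → ∀ x → v x ≡ b i x →
    columnExcept (setRow b i v) i' x ≡ columnExcept b i' x
  columnExcept-setRow-unchanged b i v i' i≢i' x v≡b =
    trans (sym (+-identityʳ _)) (columnExcept-setRow-loss b i v i' i≢i' x 0 (trans (sym v≡b) (sym (+-identityʳ _))))

  columnExcept-setRow-gain : ∀ (b : Matrix r k) i v i' → ¬ i ≡ i' → ∀ x → b i x ≤ v x →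
    columnExcept b i' x ≤ columnExcept (setRow b i v) i' x
  columnExcept-setRow-gain b i v i' i≢i' x b≤v = +-cancelʳ-≤ (b i x) _ _
    (≤-trans (+-monoʳ-≤ _ b≤v) (≤-reflexive (sym (columnExcept-setRow b i v i' i≢i' x))))

module _ {k : ℕ} where

  -- Moves β units from coordinate j to l; the truncated subtraction is exact when β ≤ u j and j ≢ l.
  shift : (Fin k → ℕ) → Fin k → Fin k → ℕ → Fin k → ℕ
  shift u j l β x = (u x + onlyIf ⌊ x ≟ l ⌋ β) ∸ onlyIf ⌊ x ≟ j ⌋ β

  module _ (u : Fin k → ℕ) {j l : Fin k} {β : ℕ} (j≢l : ¬ j ≡ l) (β≤ : β ≤ u j) where

    shift-spec : ∀ x → shift u j l β x + onlyIf ⌊ x ≟ j ⌋ β ≡ u x + onlyIf ⌊ x ≟ l ⌋ β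
    shift-spec x with x ≟ j | x ≟ l
    ... | yes refl | yes refl = ⊥-elim (j≢l refl)
    ... | yes refl | no _ = trans (cong (λ z → z ∸ β + β) (+-identityʳ (u x)))
                                  (trans (m∸n+n≡m β≤) (sym (+-identityʳ (u x))))
    ... | no _ | _ = +-identityʳ _

    ∑-shift-* : ∀ (w : Fin k → ℕ) →
      ∑ k (λ x → shift u j l β x * w x) + β * w j ≡ ∑ k (λ x → u x * w x) + β * w l
    ∑-shift-* w = begin
      ∑ k (λ x → shift u j l β x * w x) + β * w j
        ≡⟨ cong (∑ k (λ x → shift u j l β x * w x) +_) (sym (unit j)) ⟩
      ∑ k (λ x → shift u j l β x * w x) + ∑ k (λ x → onlyIf ⌊ x ≟ j ⌋ β * w x)
        ≡⟨ sym (∑-+ k _ _) ⟩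
      ∑ k (λ x → shift u j l β x * w x + onlyIf ⌊ x ≟ j ⌋ β * w x)
        ≡⟨ ∑-cong k (λ x → trans (sym (*-distribʳ-+ (w x) (shift u j l β x) _))
                          (trans (cong (_* w x) (shift-spec x)) (*-distribʳ-+ (w x) (u x) _))) ⟩
      ∑ k (λ x → u x * w x + onlyIf ⌊ x ≟ l ⌋ β * w x)
        ≡⟨ ∑-+ k _ _ ⟩
      ∑ k (λ x → u x * w x) + ∑ k (λ x → onlyIf ⌊ x ≟ l ⌋ β * w x)
        ≡⟨ cong (∑ k (λ x → u x * w x) +_) (unit l) ⟩
      ∑ k (λ x → u x * w x) + β * w l ∎
      where
      open ≡-Reasoning
      unit : ∀ m → ∑ k (λ x → onlyIf ⌊ x ≟ m ⌋ β * w x) ≡ β * w m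
      unit m = trans (∑-cong k (λ x → onlyIf-*ˡ ⌊ x ≟ m ⌋ β (w x))) (∑-onlyIf≟ k m (λ x → β * w x))

    ∑-shift : ∑ k (shift u j l β) ≡ ∑ k u
    ∑-shift = +-cancelʳ-≡ _ _ _ (begin
      ∑ k (shift u j l β) + β * 1                       ≡⟨ cong (_+ β * 1) (sym (∑-cong k (λ x → *-identityʳ _))) ⟩
      ∑ k (λ x → shift u j l β x * 1) + β * 1           ≡⟨ ∑-shift-* (λ _ → 1) ⟩
      ∑ k (λ x → u x * 1) + β * 1                       ≡⟨ cong (_+ β * 1) (∑-cong k (λ x → *-identityʳ _)) ⟩
      ∑ k u + β * 1                                     ∎)
      where open ≡-Reasoning

    shift-source : shift u j l β j ≡ u j ∸ β
    shift-source = +-cancelʳ-≡ β _ _ (trans (cong (shift u j l β j +_) (sym (onlyIf-yes (j ≟ j) refl)))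
      (trans (shift-spec j) (trans (cong (u j +_) (onlyIf-no (j ≟ l) j≢l))
        (trans (+-identityʳ (u j)) (sym (m∸n+n≡m β≤))))))

    shift-other : ∀ x → ¬ x ≡ j → ¬ x ≡ l → shift u j l β x ≡ u x
    shift-other x x≢j x≢l = trans (cong₂ (λ p q → (u x + p) ∸ q) (onlyIf-no (x ≟ l) x≢l) (onlyIf-no (x ≟ j) x≢j))
                                  (+-identityʳ (u x))

    shift-≥ : ∀ x → ¬ x ≡ j → u x ≤ shift u j l β x
    shift-≥ x x≢j = ≤-trans (m≤m+n (u x) _) (≤-reflexive (trans (sym (shift-spec x))
      (trans (cong (shift u j l β x +_) (onlyIf-no (x ≟ j) x≢j)) (+-identityʳ _))))

-- Maximisers

concentrate : ∀ {k} → Fin k → ℕ → Fin k → ℕ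
concentrate g m j = onlyIf ⌊ g ≟ j ⌋ m

∑-concentrate : ∀ {k} (g : Fin k) m → ∑ k (concentrate g m) ≡ m
∑-concentrate {k} g m = ∑-onlyIf≟ˡ k g (λ _ → m)

module _ {r k : ℕ} (n : Fin r → ℕ) where

  HasRowSums : Matrix r k → Set
  HasRowSums b = ∀ i → ∑ k (b i) ≡ n i

  IsMaximiser : Matrix r k → Set
  IsMaximiser b = HasRowSums b × (∀ b' → HasRowSums b' → crossWeight b' ≤ crossWeight b)

  setRow-rowSums : ∀ (b : Matrix r k) i v → HasRowSums b → ∑ k v ≡ n i → HasRowSums (setRow b i v)
  setRow-rowSums b i v rows v-sum a with a ≟ i
  ... | yes refl = v-sum
  ... | no _ = rows a

  othersTotal : Fin r → ℕ
  othersTotal i = ∑ r (λ a → unless ⌊ a ≟ i ⌋ (n a))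

  outside+columnExcept : ∀ (b : Matrix r k) → HasRowSums b → ∀ i j → outside b i j + columnExcept b i j ≡ othersTotal i
  outside+columnExcept b rows i j = trans (sym (∑-+ r _ _))
    (∑-cong r (λ a → trans (sym (unless-+ ⌊ a ≟ i ⌋ _ _)) (cong (unless ⌊ a ≟ i ⌋) (rowTotal a))))
    where
    open ≡-Reasoning
    rowTotal : ∀ a → ∑ k (λ j' → unless ⌊ j ≟ j' ⌋ (b a j')) + b a j ≡ n a
    rowTotal a = begin
      ∑ k (λ j' → unless ⌊ j ≟ j' ⌋ (b a j')) + b a j ≡⟨ +-comm _ (b a j) ⟩
      b a j + ∑ k (λ j' → unless ⌊ j ≟ j' ⌋ (b a j'))
        ≡⟨ cong (b a j +_) (∑-cong k (λ j' → cong (λ c → unless c (b a j')) (≟-sym j j'))) ⟩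
      b a j + ∑ k (λ j' → unless ⌊ j' ≟ j ⌋ (b a j')) ≡⟨ sym (∑-split k j (b a)) ⟩
      ∑ k (b a)                                       ≡⟨ rows a ⟩
      n a                                             ∎

  maximiser-gain≤ : ∀ {b} → IsMaximiser b → ∀ i v → ∑ k v ≡ n i → gain b i v ≤ gain b i (b i)
  maximiser-gain≤ {b} (rows , max) i v v-sum = *-cancelˡ-≤ 2 (+-cancelˡ-≤ (crossWeight b) _ _
    (≤-trans (≤-reflexive (sym (crossWeight-setRow b i v)))
             (+-monoˡ-≤ _ (max _ (setRow-rowSums b i v rows v-sum)))))

  sameGain⇒maximiser : ∀ {b} → IsMaximiser b → ∀ i v → ∑ k v ≡ n i → gain b i v ≡ gain b i (b i) →
    crossWeight (setRow b i v) ≡ crossWeight b × IsMaximiser (setRow b i v)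
  sameGain⇒maximiser {b} (rows , max) i v v-sum same =
    same-weight , setRow-rowSums b i v rows v-sum , λ b' rows' → ≤-trans (max b' rows') (≤-reflexive (sym same-weight))
    where
    same-weight = sameGain⇒sameCrossWeight b i v same

  -- First-order optimality: shifting one unit of row i from column j to column l cannot increase the gain.
  outside≤-onSupport : ∀ {b} → IsMaximiser b → ∀ i j → 1 ≤ b i j → ∀ l → outside b i l ≤ outside b i j
  outside≤-onSupport {b} mx i j pos l with j ≟ l
  ... | yes refl = ≤-refl
  ... | no j≢l = +-cancelˡ-≤ (gain b i (b i)) _ _ (begin
      gain b i (b i) + outside b i l     ≡⟨ cong (gain b i (b i) +_) (sym (*-identityˡ _)) ⟩
      gain b i (b i) + 1 * outside b i l ≡⟨ sym (∑-shift-* (b i) j≢l pos (outside b i)) ⟩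
      gain b i v + 1 * outside b i j     ≤⟨ +-monoˡ-≤ _ (maximiser-gain≤ mx i v v-sum) ⟩
      gain b i (b i) + 1 * outside b i j ≡⟨ cong (gain b i (b i) +_) (*-identityˡ _) ⟩
      gain b i (b i) + outside b i j     ∎)
    where
    open ≤-Reasoning
    v = shift (b i) j l 1
    v-sum = trans (∑-shift (b i) j≢l pos) (proj₁ mx i)

  outside-onSupport : ∀ {b} → IsMaximiser b → ∀ i j l → 1 ≤ b i j → 1 ≤ b i l → outside b i j ≡ outside b i l
  outside-onSupport mx i j l pj pl = ≤-antisym (outside≤-onSupport mx i l pl j) (outside≤-onSupport mx i j pj l)

  columnExcept≤-onSupport : ∀ {b} → IsMaximiser b → ∀ i j → 1 ≤ b i j → ∀ l → columnExcept b i j ≤ columnExcept b i l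
  columnExcept≤-onSupport {b} mx i j pos l = +-cancelˡ-≤ (outside b i l) _ _
    (≤-trans (+-monoˡ-≤ (columnExcept b i j) (outside≤-onSupport mx i j pos l))
             (≤-reflexive (trans (outside+columnExcept b (proj₁ mx) i j)
                                 (sym (outside+columnExcept b (proj₁ mx) i l)))))

  column≤column+entry : ∀ {b} → IsMaximiser b → ∀ s l m → 1 ≤ b s l → b s m ≡ 0 → column b l ≤ column b m + b s l
  column≤column+entry {b} mx s l m pos empty = begin
    column b l                    ≡⟨ columnExcept+entry b s l ⟨
    columnExcept b s l + b s l    ≤⟨ +-monoˡ-≤ (b s l) (columnExcept≤-onSupport mx s l pos m) ⟩
    columnExcept b s m + b s l    ≡⟨ cong (_+ b s l) (trans (sym (+-identityʳ _))
                                       (trans (cong (columnExcept b s m +_) (sym empty)) (columnExcept+entry b s m))) ⟩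
    column b m + b s l            ∎
    where open ≤-Reasoning

  gain-concentrate : ∀ (b : Matrix r k) i g m → gain b i (concentrate g m) ≡ m * outside b i g
  gain-concentrate b i g m = trans (∑-cong k (λ j → onlyIf-*ˡ ⌊ g ≟ j ⌋ m (outside b i j)))
                                   (∑-onlyIf≟ˡ k g (λ j → m * outside b i j))

  gain≤gain-concentrate : ∀ (b : Matrix r k) i g → ∑ k (b i) ≡ n i →
    (∀ j → outside b i j ≤ outside b i g) → gain b i (b i) ≤ gain b i (concentrate g (n i))
  gain≤gain-concentrate b i g row-sum top = begin
    ∑ k (λ j → b i j * outside b i j) ≤⟨ ∑-mono-≤ k (λ j → *-monoʳ-≤ (b i j) (top j)) ⟩
    ∑ k (λ j → b i j * outside b i g) ≡⟨ ∑-*ʳ k (outside b i g) (b i) ⟩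
    ∑ k (b i) * outside b i g         ≡⟨ cong (_* outside b i g) row-sum ⟩
    n i * outside b i g               ≡⟨ sym (gain-concentrate b i g (n i)) ⟩
    gain b i (concentrate g (n i))    ∎
    where open ≤-Reasoning

  gain-concentrate-flat : ∀ (b : Matrix r k) i g → ∑ k (b i) ≡ n i →
    (∀ j → 1 ≤ b i j → outside b i j ≡ outside b i g) → gain b i (concentrate g (n i)) ≡ gain b i (b i)
  gain-concentrate-flat b i g row-sum flat = begin
    gain b i (concentrate g (n i))     ≡⟨ gain-concentrate b i g (n i) ⟩
    n i * outside b i g               ≡⟨ cong (_* outside b i g) (sym row-sum) ⟩
    ∑ k (b i) * outside b i g         ≡⟨ sym (∑-*ʳ k (outside b i g) (b i)) ⟩
    ∑ k (λ j → b i j * outside b i g) ≡⟨ ∑-cong k term ⟩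
    ∑ k (λ j → b i j * outside b i j) ∎
    where
    open ≡-Reasoning
    term : ∀ j → b i j * outside b i g ≡ b i j * outside b i j
    term j with zero-or-pos (b i j)
    ... | inj₁ b≡0 = trans (cong (_* outside b i g) b≡0) (cong (_* outside b i j) (sym b≡0))
    ... | inj₂ pos = cong (b i j *_) (sym (flat j pos))

  maximiser-concentrate : ∀ {b} → IsMaximiser b → ∀ i g → 1 ≤ b i g →
    crossWeight (setRow b i (concentrate g (n i))) ≡ crossWeight b × IsMaximiser (setRow b i (concentrate g (n i)))
  maximiser-concentrate {b} mx i g pos = sameGain⇒maximiser mx i _ (∑-concentrate g (n i))
    (gain-concentrate-flat b i g (proj₁ mx i) (λ j pj → outside-onSupport mx i j g pj pos))

  maximiser-shift : ∀ {b} → IsMaximiser b → ∀ i {j l} β → 1 ≤ b i j → 1 ≤ b i l → ¬ j ≡ l → β ≤ b i j →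
    IsMaximiser (setRow b i (shift (b i) j l β))
  maximiser-shift {b} mx i {j} {l} β pj pl j≢l β≤ = proj₂ (sameGain⇒maximiser mx i v
    (trans (∑-shift (b i) j≢l β≤) (proj₁ mx i))
    (+-cancelʳ-≡ _ _ _ (trans (∑-shift-* (b i) j≢l β≤ (outside b i))
      (cong (λ z → gain b i (b i) + β * z) (outside-onSupport mx i l j pl pj)))))
    where v = shift (b i) j l β

  -- With more rows than columns two positive rows share a column; the column-minimality of
  -- columnExcept then forbids an empty column.
  maximiser-column-positive : ∀ {b} → IsMaximiser b → (∀ a → 1 ≤ n a) → k < r → ∀ m → 1 ≤ column b m
  maximiser-column-positive {b} mx pos k<r m with zero-or-pos (column b m)
  ... | inj₂ p = p
  ... | inj₁ empty = ⊥-elim (1+n≰n (≤-trans supported₂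
        (≤-trans (entry≤columnExcept b a₁ a₂ x (λ e → <ᶠ⇒≢ a₁<a₂ (sym e)))
        (≤-trans (columnExcept≤-onSupport mx a₁ x supported₁ m) excepted-empty))))
    where
    supportColumn : ∀ a → ∃ λ j → 1 ≤ b a j
    supportColumn a = ∑-positive k (b a) (subst (1 ≤_) (sym (proj₁ mx a)) (pos a))
    collision = pigeonhole k<r (λ a → proj₁ (supportColumn a))
    a₁ = proj₁ collision
    a₂ = proj₁ (proj₂ collision)
    a₁<a₂ = proj₁ (proj₂ (proj₂ collision))
    x = proj₁ (supportColumn a₁)
    supported₁ : 1 ≤ b a₁ x
    supported₁ = proj₂ (supportColumn a₁)
    supported₂ : 1 ≤ b a₂ x
    supported₂ = subst (λ z → 1 ≤ b a₂ z) (sym (proj₂ (proj₂ (proj₂ collision)))) (proj₂ (supportColumn a₂))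
    excepted-empty : columnExcept b a₁ m ≤ 0
    excepted-empty = ≤-trans (m≤m+n _ (b a₁ m)) (≤-reflexive (trans (columnExcept+entry b a₁ m) empty))

-- Rounding: integral matrices attain the maximum

argmax-Fin : ∀ {k} → Fin k → (w : Fin k → ℕ) → ∃ λ g → ∀ j → w j ≤ w g
argmax-Fin {k} g₀ w = argmax w g₀ (allFin k) , λ j → lookup (f[xs]≤f[argmax] g₀ (allFin k)) (∈-allFin j)

module _ {r k : ℕ} (n : Fin r → ℕ) where

  integralMatrix : (Fin r → Fin k) → Matrix r k
  integralMatrix Q a = concentrate (Q a) (n a)

  ConcentratedRow : Matrix r k → Fin r → Set
  ConcentratedRow b a = ∃ λ q → ∀ j → b a j ≡ concentrate q (n a) j

  concentrateRow-≥ : Fin k → ∀ (b : Matrix r k) i → ∑ k (b i) ≡ n i →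
    ∃ λ g → crossWeight b ≤ crossWeight (setRow b i (concentrate g (n i)))
  concentrateRow-≥ g₀ b i row-sum =
    g , gain≤⇒crossWeight≤ b i _ (gain≤gain-concentrate n b i g row-sum (proj₂ best))
    where
    best = argmax-Fin g₀ (outside b i)
    g = proj₁ best

  roundingBound : Fin k → ∀ M → (∀ Q → crossWeight (integralMatrix Q) ≤ M) →
    ∀ b → HasRowSums n b → crossWeight b ≤ M
  roundingBound g₀ M integral≤M b rows = fromRow r b rows (λ a r≤a → ⊥-elim (<⇒≱ (toℕ<n a) r≤a))
    where
    fromRow : ∀ m b → HasRowSums n b → (∀ a → m ≤ toℕ a → ConcentratedRow b a) → crossWeight b ≤ M
    fromRow zero b rows conc =
      ≤-trans (≤-reflexive (crossWeight-cong (λ a → proj₂ (conc a z≤n)))) (integral≤M (λ a → proj₁ (conc a z≤n)))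
    fromRow (suc m) b rows conc with m ℕ.<? r
    ... | no m≮r = fromRow m b rows (λ a m≤a → ⊥-elim (<⇒≱ (toℕ<n a) (≤-trans (≮⇒≥ m≮r) m≤a)))
    ... | yes m<r = ≤-trans (proj₂ improved)
        (fromRow m b' (setRow-rowSums n b i _ rows (∑-concentrate g (n i))) conc')
      where
      i = fromℕ< m<r
      improved = concentrateRow-≥ g₀ b i (rows i)
      g = proj₁ improved
      b' = setRow b i (concentrate g (n i))
      conc' : ∀ a → m ≤ toℕ a → ConcentratedRow b' a
      conc' a m≤a with a ≟ i
      ... | yes refl = g , λ j → refl
      ... | no a≢i = conc a (≤∧≢⇒< m≤a (λ m≡a →
        a≢i (toℕ-injective (trans (sym m≡a) (sym (toℕ-fromℕ< m<r))))))

-- Partial entries and the shape of a maximiser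

module PartialStructure {r k : ℕ} (n : Fin r → ℕ) (B : Matrix r k) where

  PartialEntry : Fin r → Fin k → Set
  PartialEntry i j = 1 ≤ B i j × ¬ B i j ≡ n i

  partialEntry? : ∀ i j → Dec (PartialEntry i j)
  partialEntry? i j = (1 ≤? B i j) ×-dec ¬? (B i j ℕ.≟ n i)

  integralMass : Fin k → ℕ
  integralMass j = ∑ r (λ a → onlyIf ⌊ B a j ℕ.≟ n a ⌋ (B a j))

  OnePartialPerColumn : Set
  OnePartialPerColumn = ∀ j i i' → PartialEntry i j → PartialEntry i' j → i ≡ i'

  EqualIntegralMasses : Set
  EqualIntegralMasses = ∀ i i' j j' → PartialEntry i j → PartialEntry i' j' → integralMass j ≡ integralMass j'

  integralMass≡column : ∀ j → (∀ a → ¬ PartialEntry a j) → integralMass j ≡ column B j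
  integralMass≡column j none = ∑-cong r entry
    where
    entry : ∀ a → onlyIf ⌊ B a j ℕ.≟ n a ⌋ (B a j) ≡ B a j
    entry a with B a j ℕ.≟ n a
    ... | yes _ = refl
    ... | no ≢n with zero-or-pos (B a j)
    ...   | inj₁ ≡0 = sym ≡0
    ...   | inj₂ pos = ⊥-elim (none a (pos , ≢n))

  columnExcept≡integralMass : OnePartialPerColumn → ∀ i j → PartialEntry i j → columnExcept B i j ≡ integralMass j
  columnExcept≡integralMass one i j partial = ∑-cong r entry
    where
    entry : ∀ a → unless ⌊ a ≟ i ⌋ (B a j) ≡ onlyIf ⌊ B a j ℕ.≟ n a ⌋ (B a j)
    entry a with a ≟ i
    ... | yes refl = sym (onlyIf-no (B a j ℕ.≟ n a) (proj₂ partial))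
    ... | no a≢i with zero-or-pos (B a j)
    ...   | inj₁ ≡0 = trans ≡0 (sym (trans (cong (λ z → onlyIf ⌊ z ℕ.≟ n a ⌋ z) ≡0) (onlyIf-zero _)))
    ...   | inj₂ pos with B a j ℕ.≟ n a
    ...     | yes _ = refl
    ...     | no ≢n = ⊥-elim (a≢i (one j a i (pos , ≢n) partial))

  module _ (rows : HasRowSums n B) where

    full⇒zeroElsewhere : ∀ i j → B i j ≡ n i → ∀ l → ¬ l ≡ j → B i l ≡ 0
    full⇒zeroElsewhere i j full l l≢j = n≤0⇒n≡0 (+-cancelˡ-≤ (B i j) _ 0
      (≤-trans (+-monoʳ-≤ (B i j) (≤-trans (≤-reflexive (sym (unless-no (l ≟ j) l≢j)))
                                             (term≤∑ k (λ l' → unless ⌊ l' ≟ j ⌋ (B i l')) l)))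
               (≤-reflexive (trans (sym (∑-split k j (B i)))
                                   (trans (rows i) (trans (sym full) (sym (+-identityʳ _))))))))

    partial⇒otherSupport : ∀ i j → PartialEntry i j → ∃ λ l → ¬ l ≡ j × 1 ≤ B i l
    partial⇒otherSupport i j (_ , ≢n) = ∑-except-positive k j (B i) rest-positive
      where
      rest-positive : 1 ≤ ∑ k (λ l → unless ⌊ l ≟ j ⌋ (B i l))
      rest-positive with zero-or-pos (∑ k (λ l → unless ⌊ l ≟ j ⌋ (B i l)))
      ... | inj₂ p = p
      ... | inj₁ ≡0 = ⊥-elim (≢n (trans (sym (+-identityʳ (B i j)))
                        (trans (cong (B i j +_) (sym ≡0)) (trans (sym (∑-split k j (B i))) (rows i)))))

    partial-onSupport : ∀ i j l → PartialEntry i j → 1 ≤ B i l → PartialEntry i l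
    partial-onSupport i j l (pos , ≢n) pos' = pos' , λ full → 1+n≰n (≤-trans pos (≤-reflexive
      (full⇒zeroElsewhere i l full j (λ { refl → ≢n full }))))

    partial-excludes : OnePartialPerColumn → ∀ {i a j j₁} → PartialEntry i j → PartialEntry a j₁ → ¬ a ≡ i → B a j ≡ 0
    partial-excludes one {i} {a} {j} {j₁} pi pa a≢i with zero-or-pos (B a j)
    ... | inj₁ ≡0 = ≡0
    ... | inj₂ pos = ⊥-elim (a≢i (one j a i (partial-onSupport a j₁ j pa pos) pi))

module MaximiserStructure {r k : ℕ} (n : Fin r → ℕ) (B : Matrix r k) (mx : IsMaximiser n B) where
  open PartialStructure n B

  private
    rows : HasRowSums n B
    rows = proj₁ mx

  -- If V_i and V_i' were both partial in P_j, moving one vertex of V_i out of P_j would keep B a maximiser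
  -- while making the minimality of columnExcept for row i' fail by one.
  onePartial : OnePartialPerColumn
  onePartial j i i' pi pi' with i ≟ i'
  ... | yes i≡i' = i≡i'
  ... | no i≢i' = ⊥-elim (1+n≰n (begin
      suc (columnExcept b' i' j) ≡⟨ +-comm 1 _ ⟩
      columnExcept b' i' j + 1   ≡⟨ columnExcept-setRow-loss B i v i' i≢i' j 1 source ⟩
      columnExcept B i' j        ≤⟨ columnExcept≤-onSupport n mx i' j (proj₁ pi') m ⟩
      columnExcept B i' m        ≤⟨ columnExcept-setRow-gain B i v i' i≢i' m (shift-≥ (B i) j≢l (proj₁ pi) m m≢j) ⟩
      columnExcept b' i' m       ≤⟨ columnExcept≤-onSupport n mx' i' m (subst (1 ≤_) (sym (row-i' m)) pm) j ⟩
      columnExcept b' i' j       ∎))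
    where
    open ≤-Reasoning
    other = partial⇒otherSupport rows i j pi
    l = proj₁ other
    j≢l : ¬ j ≡ l
    j≢l j≡l = proj₁ (proj₂ other) (sym j≡l)
    other' = partial⇒otherSupport rows i' j pi'
    m = proj₁ other'
    m≢j = proj₁ (proj₂ other')
    pm = proj₂ (proj₂ other')
    v = shift (B i) j l 1
    b' = setRow B i v
    mx' = maximiser-shift n mx i 1 (proj₁ pi) (proj₂ (proj₂ other)) j≢l (proj₁ pi)
    row-i' : ∀ x → b' i' x ≡ B i' x
    row-i' = setRow-other B i v i' (λ e → i≢i' (sym e))
    source : B i j ≡ v j + 1
    source = trans (sym (m∸n+n≡m (proj₁ pi))) (cong (_+ 1) (sym (shift-source (B i) j≢l (proj₁ pi))))

  columnExcept≤column : ∀ i j → 1 ≤ B i j → ∀ j' → columnExcept B i j ≤ column B j'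
  columnExcept≤column i j pos j' = ≤-trans (columnExcept≤-onSupport n mx i j pos j')
    (≤-trans (m≤m+n _ (B i j')) (≤-reflexive (columnExcept+entry B i j')))

  private
    evacuate : Fin r → Fin k → Fin k → Matrix r k
    evacuate i' j' m = setRow B i' (shift (B i') j' m (B i' j'))

  -- Once row i' has left column j', the rest of column j' is exactly its integral part.
  columnExcept-evacuate : ∀ i i' j' m → ¬ i' ≡ i → PartialEntry i' j' → ¬ j' ≡ m → B i j' ≡ 0 →
    columnExcept (evacuate i' j' m) i j' ≡ integralMass j'
  columnExcept-evacuate i i' j' m i'≢i pi' j'≢m B≡0 = trans (+-cancelʳ-≡ (B i' j') _ _ (begin
      columnExcept (evacuate i' j' m) i j' + B i' j'
        ≡⟨ columnExcept-setRow-loss B i' (shift (B i') j' m (B i' j')) i i'≢i j' (B i' j') emptied ⟩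
      columnExcept B i j'                  ≡⟨ sym (trans (cong (columnExcept B i j' +_) B≡0) (+-identityʳ _)) ⟩
      columnExcept B i j' + B i j'         ≡⟨ columnExcept+entry B i j' ⟩
      column B j'                          ≡⟨ sym (columnExcept+entry B i' j') ⟩
      columnExcept B i' j' + B i' j'       ∎))
    (columnExcept≡integralMass onePartial i' j' pi')
    where
    open ≡-Reasoning
    emptied : B i' j' ≡ shift (B i') j' m (B i' j') j' + B i' j'
    emptied = cong (_+ B i' j') (sym (trans (shift-source (B i') j'≢m ≤-refl) (n∸n≡0 (B i' j'))))

  integralMass≤ : ∀ i i' j j' → PartialEntry i j → PartialEntry i' j' → integralMass j ≤ integralMass j'
  integralMass≤ i i' j j' pi pi' with i ≟ i' | j ≟ j'
  ... | yes refl | _ = begin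
      integralMass j      ≡⟨ sym (columnExcept≡integralMass onePartial i j pi) ⟩
      columnExcept B i j  ≤⟨ columnExcept≤-onSupport n mx i j (proj₁ pi) j' ⟩
      columnExcept B i j' ≡⟨ columnExcept≡integralMass onePartial i j' pi' ⟩
      integralMass j'     ∎
    where open ≤-Reasoning
  ... | no _ | yes refl = ≤-refl
  ... | no i≢i' | no j≢j' = begin
      integralMass j      ≡⟨ sym (columnExcept≡integralMass onePartial i j pi) ⟩
      columnExcept B i j  ≡⟨ columnExcept-setRow-unchanged B i' v i i'≢i j (shift-other (B i') j'≢m ≤-refl j j≢j' j≢m) ⟨
      columnExcept b' i j ≤⟨ columnExcept≤-onSupport n mx' i j (subst (1 ≤_) (sym (row-i j)) (proj₁ pi)) j' ⟩
      columnExcept b' i j' ≡⟨ columnExcept-evacuate i i' j' m i'≢i pi' j'≢m B≡0 ⟩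
      integralMass j'     ∎
    where
    open ≤-Reasoning
    i'≢i : ¬ i' ≡ i
    i'≢i e = i≢i' (sym e)
    other = partial⇒otherSupport rows i' j' pi'
    m = proj₁ other
    j'≢m : ¬ j' ≡ m
    j'≢m e = proj₁ (proj₂ other) (sym e)
    pm = proj₂ (proj₂ other)
    j≢m : ¬ j ≡ m
    j≢m refl = i≢i' (onePartial j i i' pi (partial-onSupport rows i' j' j pi' pm))
    v = shift (B i') j' m (B i' j')
    b' = evacuate i' j' m
    mx' = maximiser-shift n mx i' (B i' j') (proj₁ pi') pm j'≢m ≤-refl
    row-i : ∀ x → b' i x ≡ B i x
    row-i = setRow-other B i' _ i i≢i'
    B≡0 : B i j' ≡ 0
    B≡0 = partial-excludes rows onePartial pi' pi i≢i'

  integralMass-equal : EqualIntegralMasses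
  integralMass-equal i i' j j' pi pi' = ≤-antisym (integralMass≤ i i' j j' pi pi') (integralMass≤ i' i j' j pi' pi)

  integralMass≤column : ∀ i j j' → PartialEntry i j → integralMass j ≤ column B j'
  integralMass≤column i j j' pi =
    ≤-trans (≤-reflexive (sym (columnExcept≡integralMass onePartial i j pi))) (columnExcept≤column i j (proj₁ pi) j')

  beside-partial⇒full : ∀ s i l → ¬ s ≡ i → 1 ≤ B s l → PartialEntry i l → B s l ≡ n s
  beside-partial⇒full s i l s≢i pos pi with B s l ℕ.≟ n s
  ... | yes full = full
  ... | no ≢n = ⊥-elim (s≢i (onePartial l s i (pos , ≢n) pi))

  module _ (pos : ∀ a → 1 ≤ n a) (k<r : k < r) where

    -- Concentrate row i on column l. A second support column m of row i then carries exactly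
    -- A = columnExcept B i l, which is positive since no column of a maximiser is empty; so a full row s
    -- shares column l with row i, and column≤column+entry for s gives A + n i ≤ A + n s.
    partialRow≤integralMass : ∀ i l → PartialEntry i l → n i ≤ integralMass l
    partialRow≤integralMass i l pi = begin
      n i             ≤⟨ +-cancelˡ-≤ A _ _ (begin
                           A + n i              ≡⟨ trans (column-setRow B i v l) (cong (A +_) (onlyIf-yes (l ≟ l) refl)) ⟨
                           column b' l          ≤⟨ column≤column+entry n mx' s l m (subst (1 ≤_) (sym (row-s l)) psl)
                                                     (trans (row-s m) (full⇒zeroElsewhere rows s l full m m≢l)) ⟩
                           column b' m + b' s l ≡⟨ cong₂ _+_ column-m (trans (row-s l) full) ⟩
                           A + n s              ∎) ⟩
      n s             ≡⟨ full ⟨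
      B s l           ≤⟨ entry≤columnExcept B i s l s≢i ⟩
      A               ≡⟨ columnExcept≡integralMass onePartial i l pi ⟩
      integralMass l  ∎
      where
      open ≤-Reasoning
      A = columnExcept B i l
      other = partial⇒otherSupport rows i l pi
      m = proj₁ other
      m≢l = proj₁ (proj₂ other)
      v = concentrate l (n i)
      b' = setRow B i v
      mx' = proj₂ (maximiser-concentrate n mx i l (proj₁ pi))
      column-m : column b' m ≡ A
      column-m = trans (column-setRow B i v m)
        (trans (cong (columnExcept B i m +_) (onlyIf-no (l ≟ m) (λ e → m≢l (sym e))))
        (trans (+-identityʳ _) (≤-antisym (columnExcept≤-onSupport n mx i m (proj₂ (proj₂ other)) l)
                                          (columnExcept≤-onSupport n mx i l (proj₁ pi) m))))
      sharing = ∑-except-positive r i (λ a → B a l) (subst (1 ≤_) column-m (maximiser-column-positive n mx' pos k<r m))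
      s = proj₁ sharing
      s≢i = proj₁ (proj₂ sharing)
      psl = proj₂ (proj₂ sharing)
      full : B s l ≡ n s
      full = beside-partial⇒full s i l s≢i psl pi
      row-s : ∀ x → b' s x ≡ B s x
      row-s = setRow-other B i v s s≢i

    partialRow≤integralMass-any : ∀ j i l → PartialEntry i l → n i ≤ integralMass j
    partialRow≤integralMass-any j i l pi with any? (λ a → partialEntry? a j)
    ... | yes (a , pa) = ≤-trans (partialRow≤integralMass i l pi) (≤-reflexive (integralMass-equal i a l j pi pa))
    ... | no none = ≤-trans (partialRow≤integralMass i l pi)
      (≤-trans (integralMass≤column i l j pi) (≤-reflexive (sym (integralMass≡column j (λ a p → none (a , p))))))

    -- A partial row i' of column j' is evacuated first; row i can only gain in column j by this.
    integralRow-columnExcept≤ : ∀ j i → B i j ≡ n i → ∀ j' → ¬ j ≡ j' → columnExcept B i j ≤ integralMass j'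
    integralRow-columnExcept≤ j i full j' j≢j' with any? (λ a → partialEntry? a j')
    ... | no none = ≤-trans (columnExcept≤column i j (subst (1 ≤_) (sym full) (pos i)) j')
                            (≤-reflexive (sym (integralMass≡column j' (λ a p → none (a , p)))))
    ... | yes (i' , pi') = begin
      columnExcept B i j   ≤⟨ columnExcept-setRow-gain B i' v i i'≢i j (shift-≥ (B i') j'≢m ≤-refl j j≢j') ⟩
      columnExcept b' i j  ≤⟨ columnExcept≤-onSupport n mx' i j (subst (1 ≤_) (sym (trans (row-i j) full)) (pos i)) j' ⟩
      columnExcept b' i j' ≡⟨ columnExcept-evacuate i i' j' m i'≢i pi' j'≢m B≡0 ⟩
      integralMass j'      ∎
      where
      open ≤-Reasoning
      B≡0 : B i j' ≡ 0
      B≡0 = full⇒zeroElsewhere rows i j full j' (λ e → j≢j' (sym e))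
      i'≢i : ¬ i' ≡ i
      i'≢i refl = 1+n≰n (≤-trans (proj₁ pi') (≤-reflexive B≡0))
      other = partial⇒otherSupport rows i' j' pi'
      m = proj₁ other
      j'≢m : ¬ j' ≡ m
      j'≢m e = proj₁ (proj₂ other) (sym e)
      v = shift (B i') j' m (B i' j')
      b' = setRow B i' v
      mx' = maximiser-shift n mx i' (B i' j') (proj₁ pi') (proj₂ (proj₂ other)) j'≢m ≤-refl
      row-i : ∀ x → b' i x ≡ B i x
      row-i = setRow-other B i' v i (λ e → i'≢i (sym e))

-- Internalisation

module _ {r k : ℕ} (B B' : Matrix r k) where

  Mixture : Matrix r k → Set
  Mixture b = ∀ a → (∀ j → b a j ≡ B a j) ⊎ (∀ j → b a j ≡ B' a j)

  private
    prefix : ℕ → Matrix r k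
    prefix m a j = if ⌊ toℕ a ℕ.<? m ⌋ then B' a j else B a j

    prefix-mixture : ∀ m → Mixture (prefix m)
    prefix-mixture m a with toℕ a ℕ.<? m
    ... | yes _ = inj₂ (λ j → refl)
    ... | no _ = inj₁ (λ j → refl)

    prefix-zero : ∀ a j → prefix 0 a j ≡ B a j
    prefix-zero a j with toℕ a ℕ.<? 0
    ... | no _ = refl

    prefix-full : ∀ a j → prefix r a j ≡ B' a j
    prefix-full a j with toℕ a ℕ.<? r
    ... | yes _ = refl
    ... | no a≮r = ⊥-elim (a≮r (toℕ<n a))

    prefix-at : ∀ m i → toℕ i ≡ m → ∀ j → prefix m i j ≡ B i j
    prefix-at m i refl j with toℕ i ℕ.<? toℕ i
    ... | yes i<i = ⊥-elim (<-irrefl refl i<i)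
    ... | no _ = refl

    prefix-suc : ∀ m i → toℕ i ≡ m → ∀ a j → prefix (suc m) a j ≡ setRow (prefix m) i (B' i) a j
    prefix-suc m i i≡m a j with a ≟ i
    ... | yes refl with toℕ a ℕ.<? suc m
    ...   | yes _ = refl
    ...   | no a≮ = ⊥-elim (a≮ (s≤s (≤-reflexive i≡m)))
    prefix-suc m i i≡m a j | no a≢i with toℕ a ℕ.<? suc m | toℕ a ℕ.<? m
    ... | yes _ | yes _ = refl
    ... | no _ | no _ = refl
    ... | yes a<1+m | no a≮m =
      ⊥-elim (a≢i (toℕ-injective (trans (≤-antisym (≤-pred a<1+m) (≮⇒≥ a≮m)) (sym i≡m))))
    ... | no a≮1+m | yes a<m = ⊥-elim (a≮1+m (m<n⇒m<1+n a<m))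

  crossWeight-rowwise :
    (∀ b i → Mixture b → (∀ j → b i j ≡ B i j) → crossWeight b ≡ crossWeight B →
       crossWeight (setRow b i (B' i)) ≡ crossWeight b) →
    crossWeight B' ≡ crossWeight B
  crossWeight-rowwise step = trans (sym (crossWeight-cong prefix-full)) (upTo r ≤-refl)
    where
    upTo : ∀ m → m ≤ r → crossWeight (prefix m) ≡ crossWeight B
    upTo zero _ = crossWeight-cong prefix-zero
    upTo (suc m) m<r = trans (crossWeight-cong (prefix-suc m i i≡m))
      (trans (step (prefix m) i (prefix-mixture m) (prefix-at m i i≡m) previous) previous)
      where
      i = fromℕ< m<r
      i≡m = toℕ-fromℕ< m<r
      previous = upTo m (<⇒≤ m<r)

module Internalisation {r k : ℕ} (n : Fin r → ℕ) (B B' : Matrix r k) (rows : HasRowSums n B) where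
  open PartialStructure n B

  InternalisedRow : Fin r → Set
  InternalisedRow i = (∀ j → B' i j ≡ B i j)
    ⊎ ((∃ λ j₀ → PartialEntry i j₀) × ∃ λ g → 1 ≤ B i g × ∀ j → B' i j ≡ concentrate g (n i) j)

  module _ (internalised : ∀ i → InternalisedRow i) where

    keep-row : ∀ b i → (∀ j → B' i j ≡ B i j) → (∀ j → b i j ≡ B i j) →
      crossWeight (setRow b i (B' i)) ≡ crossWeight b
    keep-row b i unchanged bi≡Bi = crossWeight-cong (setRow-id b i (λ j → trans (unchanged j) (sym (bi≡Bi j))))

    mixture-rowSums : ∀ b → Mixture B B' b → HasRowSums n b
    mixture-rowSums b mix a with mix a | internalised a
    ... | inj₁ same | _ = trans (∑-cong k same) (rows a)
    ... | inj₂ new | inj₁ same = trans (∑-cong k new) (trans (∑-cong k same) (rows a))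
    ... | inj₂ new | inj₂ (_ , g , _ , conc) = trans (∑-cong k new) (trans (∑-cong k conc) (∑-concentrate g (n a)))

    maximiser-internalisation : IsMaximiser n B → crossWeight B' ≡ crossWeight B
    maximiser-internalisation (_ , max) = crossWeight-rowwise B B' step
      where
      step : ∀ b i → Mixture B B' b → (∀ j → b i j ≡ B i j) → crossWeight b ≡ crossWeight B →
             crossWeight (setRow b i (B' i)) ≡ crossWeight b
      step b i mix bi≡Bi same with internalised i
      ... | inj₁ unchanged = keep-row b i unchanged bi≡Bi
      ... | inj₂ (_ , g , pg , conc) = trans (crossWeight-cong (setRow-cong b i conc))
          (proj₁ (maximiser-concentrate n mx-b i g (subst (1 ≤_) (sym (bi≡Bi g)) pg)))
        where
        mx-b : IsMaximiser n b
        mx-b = mixture-rowSums b mix , λ b'' rows'' → ≤-trans (max b'' rows'') (≤-reflexive (sym same))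

    -- Under stability conditions (1) and (2), columnExcept b i j equals the common integral mass on the support
    -- of a partial row i that is still original in the mixture b; so outside b i is flat there.
    module _ (one : OnePartialPerColumn) (equal : EqualIntegralMasses) where

      mixture-column : ∀ b → Mixture B B' b → ∀ i j → PartialEntry i j → ∀ a → ¬ a ≡ i → b a j ≡ B a j
      mixture-column b mix i j pi a a≢i with mix a | internalised a
      ... | inj₁ same | _ = same j
      ... | inj₂ new | inj₁ same = trans (new j) (same j)
      ... | inj₂ new | inj₂ ((j₁ , pa) , g , pg , conc) =
        trans (new j) (trans (conc j) (trans (onlyIf-no (g ≟ j) g≢j) (sym B≡0)))
        where
        B≡0 = partial-excludes rows one pi pa a≢i
        g≢j : ¬ g ≡ j
        g≢j refl = 1+n≰n (≤-trans pg (≤-reflexive B≡0))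

      mixture-columnExcept : ∀ b → Mixture B B' b → ∀ i j → PartialEntry i j → columnExcept b i j ≡ integralMass j
      mixture-columnExcept b mix i j pi = trans (∑-cong r entry) (columnExcept≡integralMass one i j pi)
        where
        entry : ∀ a → unless ⌊ a ≟ i ⌋ (b a j) ≡ unless ⌊ a ≟ i ⌋ (B a j)
        entry a with a ≟ i
        ... | yes _ = refl
        ... | no a≢i = mixture-column b mix i j pi a a≢i

      stable-internalisation : crossWeight B' ≡ crossWeight B
      stable-internalisation = crossWeight-rowwise B B' step
        where
        step : ∀ b i → Mixture B B' b → (∀ j → b i j ≡ B i j) → crossWeight b ≡ crossWeight B →
               crossWeight (setRow b i (B' i)) ≡ crossWeight b
        step b i mix bi≡Bi _ with internalised i
        ... | inj₁ unchanged = keep-row b i unchanged bi≡Bi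
        ... | inj₂ ((j₀ , pi₀) , g , pg , conc) = trans (crossWeight-cong (setRow-cong b i conc))
            (sameGain⇒sameCrossWeight b i _ (gain-concentrate-flat n b i g (rows-b i) flat))
          where
          rows-b = mixture-rowSums b mix
          partial : ∀ j → 1 ≤ B i j → PartialEntry i j
          partial j = partial-onSupport rows i j₀ j pi₀
          flat : ∀ j → 1 ≤ b i j → outside b i j ≡ outside b i g
          flat j pj' = +-cancelʳ-≡ (columnExcept b i j) _ _ (begin
            outside b i j + columnExcept b i j ≡⟨ outside+columnExcept n b rows-b i j ⟩
            othersTotal {k = k} n i            ≡⟨ sym (outside+columnExcept n b rows-b i g) ⟩
            outside b i g + columnExcept b i g ≡⟨ cong (outside b i g +_) (begin
                columnExcept b i g  ≡⟨ mixture-columnExcept b mix i g (partial g pg) ⟩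
                integralMass g      ≡⟨ equal i i g j (partial g pg) (partial j pj) ⟩
                integralMass j      ≡⟨ sym (mixture-columnExcept b mix i j (partial j pj)) ⟩
                columnExcept b i j  ∎) ⟩
            outside b i g + columnExcept b i j ∎)
            where
            open ≡-Reasoning
            pj = subst (1 ≤_) (bi≡Bi j) pj'

-- Counting edges through the intersection matrix

∑∑-symmetric : ∀ m (G : Fin m → Fin m → ℕ) → (∀ x y → G x y ≡ G y x) → (∀ x → G x x ≡ 0) →
  ∑ m (λ x → ∑ m (λ y → G x y)) ≡ 2 * ∑ m (λ x → ∑ m (λ y → onlyIf ⌊ x <? y ⌋ (G x y)))
∑∑-symmetric m G symmetric diagonal = begin
  ∑ m (λ x → ∑ m (λ y → G x y))
    ≡⟨ ∑-cong m (λ x → trans (∑-cong m (λ y → byOrder x y)) (∑-+ m _ _)) ⟩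
  ∑ m (λ x → ∑ m (λ y → onlyIf ⌊ x <? y ⌋ (G x y)) + ∑ m (λ y → onlyIf ⌊ y <? x ⌋ (G x y)))
    ≡⟨ ∑-+ m _ _ ⟩
  Z + ∑ m (λ x → ∑ m (λ y → onlyIf ⌊ y <? x ⌋ (G x y)))
    ≡⟨ cong (Z +_) (trans (∑-swap m m _)
         (∑-cong m (λ y → ∑-cong m (λ x → cong (onlyIf ⌊ y <? x ⌋) (symmetric x y))))) ⟩
  Z + Z ≡⟨ cong (Z +_) (sym (+-identityʳ Z)) ⟩
  2 * Z ∎
  where
  open ≡-Reasoning
  Z = ∑ m (λ x → ∑ m (λ y → onlyIf ⌊ x <? y ⌋ (G x y)))
  byOrder : ∀ x y → G x y ≡ onlyIf ⌊ x <? y ⌋ (G x y) + onlyIf ⌊ y <? x ⌋ (G x y)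
  byOrder x y with <-cmp x y
  ... | tri< x<y _ _ = sym (trans (cong₂ _+_ (onlyIf-yes (x <? y) x<y) (onlyIf-no (y <? x) (<-asym x<y))) (+-identityʳ _))
  ... | tri≈ _ refl _ = trans (diagonal x) (sym (cong₂ _+_
        (trans (cong (onlyIf ⌊ x <? x ⌋) (diagonal x)) (onlyIf-zero _))
        (trans (cong (onlyIf ⌊ x <? x ⌋) (diagonal x)) (onlyIf-zero _))))
  ... | tri> _ _ y<x = sym (cong₂ _+_ (onlyIf-no (x <? y) (<-asym y<x)) (onlyIf-yes (y <? x) y<x))

module Intersection {N r k : ℕ} (c : Fin N → Fin r) (P : Fin N → Fin k) where

  intersection : Matrix r k
  intersection i j = count (λ x → (c x ≟ i) ×-dec (P x ≟ j))

  indicator : Fin N → Fin r → Fin k → ℕ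
  indicator x i j = onlyIf ⌊ (c x ≟ i) ×-dec (P x ≟ j) ⌋ 1

  private
    indicator-* : ∀ x i j y → indicator x i j * y ≡ onlyIf ⌊ c x ≟ i ⌋ (onlyIf ⌊ P x ≟ j ⌋ y)
    indicator-* x i j y with c x ≟ i | P x ≟ j
    ... | yes _ | yes _ = +-identityʳ y
    ... | yes _ | no _ = refl
    ... | no _ | yes _ = refl
    ... | no _ | no _ = refl

    cell : ∀ (h : Fin r → Fin k → ℕ) x → ∑ r (λ i → ∑ k (λ j → indicator x i j * h i j)) ≡ h (c x) (P x)
    cell h x = begin
      ∑ r (λ i → ∑ k (λ j → indicator x i j * h i j))
        ≡⟨ ∑-cong r (λ i → trans (∑-cong k (λ j → indicator-* x i j (h i j)))
                                 (sym (onlyIf-∑ ⌊ c x ≟ i ⌋ k _))) ⟩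
      ∑ r (λ i → onlyIf ⌊ c x ≟ i ⌋ (∑ k (λ j → onlyIf ⌊ P x ≟ j ⌋ (h i j))))
        ≡⟨ ∑-cong r (λ i → cong (onlyIf ⌊ c x ≟ i ⌋) (∑-onlyIf≟ˡ k (P x) (h i))) ⟩
      ∑ r (λ i → onlyIf ⌊ c x ≟ i ⌋ (h i (P x)))
        ≡⟨ ∑-onlyIf≟ˡ r (c x) (λ i → h i (P x)) ⟩
      h (c x) (P x) ∎
      where open ≡-Reasoning

  ∑-byCells : ∀ (h : Fin r → Fin k → ℕ) →
    ∑ N (λ x → h (c x) (P x)) ≡ ∑ r (λ i → ∑ k (λ j → intersection i j * h i j))
  ∑-byCells h = begin
    ∑ N (λ x → h (c x) (P x))
      ≡⟨ ∑-cong N (λ x → sym (cell h x)) ⟩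
    ∑ N (λ x → ∑ r (λ i → ∑ k (λ j → indicator x i j * h i j)))
      ≡⟨ trans (∑-swap N r _) (∑-cong r (λ i → ∑-swap N k _)) ⟩
    ∑ r (λ i → ∑ k (λ j → ∑ N (λ x → indicator x i j * h i j)))
      ≡⟨ ∑-cong r (λ i → ∑-cong k (λ j → ∑-*ʳ N (h i j) (λ x → indicator x i j))) ⟩
    ∑ r (λ i → ∑ k (λ j → intersection i j * h i j)) ∎
    where open ≡-Reasoning

  count-byCells : ∀ {A : Fin r → Fin k → Set} (A? : ∀ i j → Dec (A i j)) →
    count (λ x → A? (c x) (P x)) ≡ ∑ r (λ i → ∑ k (λ j → onlyIf ⌊ A? i j ⌋ (intersection i j)))
  count-byCells A? = trans (∑-byCells (λ i j → onlyIf ⌊ A? i j ⌋ 1))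
    (∑-cong r (λ i → ∑-cong k (λ j → times-indicator (intersection i j) (A? i j))))
    where
    times-indicator : ∀ {A : Set} y (d : Dec A) → y * onlyIf ⌊ d ⌋ 1 ≡ onlyIf ⌊ d ⌋ y
    times-indicator y (yes _) = *-identityʳ y
    times-indicator y (no _) = *-zeroʳ y

  edges≡crossWeight : 2 * edgesP c P ≡ crossWeight intersection
  edges≡crossWeight = begin
    2 * edgesP c P
      ≡⟨ cong (2 *_) (∑-cong N (λ x → ∑-cong N (λ y → orderedEdge x y))) ⟩
    2 * ∑ N (λ x → ∑ N (λ y → onlyIf ⌊ x <? y ⌋ (G x y)))
      ≡⟨ ∑∑-symmetric N G (λ x y → cong₂ (λ p q → unless p (unless q 1)) (≟-sym (c x) (c y)) (≟-sym (P x) (P y)))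
                           (λ x → cong (λ p → unless p (unless ⌊ P x ≟ P x ⌋ 1)) (≟-refl (c x))) ⟨
    ∑ N (λ x → ∑ N (λ y → G x y))
      ≡⟨ ∑-cong N (λ x → ∑-byCells (λ i j → unless ⌊ c x ≟ i ⌋ (unless ⌊ P x ≟ j ⌋ 1))) ⟩
    ∑ N (λ x → H (c x) (P x))
      ≡⟨ ∑-byCells H ⟩
    ∑ r (λ a → ∑ k (λ j → intersection a j * H a j))
      ≡⟨ ∑-cong r (λ a → ∑-cong k (λ j → trans (sym (∑-*ˡ r (intersection a j) _))
                                              (∑-cong r (λ a' → sym (∑-*ˡ k (intersection a j) _))))) ⟩
    ∑ r (λ a → ∑ k (λ j → ∑ r (λ a' → ∑ k (λ j' → intersection a j * (intersection a' j' * separated a a' j j')))))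
      ≡⟨ ∑-cong r (λ a → ∑-swap k r _) ⟩
    ∑ r (λ a → ∑ r (λ a' → ∑ k (λ j → ∑ k (λ j' → intersection a j * (intersection a' j' * separated a a' j j')))))
      ≡⟨ ∑-cong r (λ a → ∑-cong r (λ a' → pair a a')) ⟩
    crossWeight intersection ∎
    where
    open ≡-Reasoning
    G : Fin N → Fin N → ℕ
    G x y = unless ⌊ c x ≟ c y ⌋ (unless ⌊ P x ≟ P y ⌋ 1)
    separated : Fin r → Fin r → Fin k → Fin k → ℕ
    separated a a' j j' = unless ⌊ a ≟ a' ⌋ (unless ⌊ j ≟ j' ⌋ 1)
    H : Fin r → Fin k → ℕ
    H a j = ∑ r (λ a' → ∑ k (λ j' → intersection a' j' * separated a a' j j'))
    orderedEdge : ∀ x y → (if ⌊ (x <? y) ×-dec (¬? (c x ≟ c y) ×-dec ¬? (P x ≟ P y)) ⌋ then 1 else 0)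
                        ≡ onlyIf ⌊ x <? y ⌋ (G x y)
    orderedEdge x y with x <? y | c x ≟ c y | P x ≟ P y
    ... | yes _ | yes _ | _ = refl
    ... | yes _ | no _ | yes _ = refl
    ... | yes _ | no _ | no _ = refl
    ... | no _ | _ | _ = refl
    weighted : ∀ u v p q → u * (v * unless p (unless q 1)) ≡ unless p (unless q (u * v))
    weighted u v true q = trans (cong (u *_) (*-zeroʳ v)) (*-zeroʳ u)
    weighted u v false true = trans (cong (u *_) (*-zeroʳ v)) (*-zeroʳ u)
    weighted u v false false = cong (u *_) (*-identityʳ v)
    pair : ∀ a a' → ∑ k (λ j → ∑ k (λ j' → intersection a j * (intersection a' j' * separated a a' j j')))
                  ≡ unless ⌊ a ≟ a' ⌋ (across (intersection a) (intersection a'))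
    pair a a' = trans
      (∑-cong k (λ j → ∑-cong k (λ j' → weighted (intersection a j) (intersection a' j') ⌊ a ≟ a' ⌋ ⌊ j ≟ j' ⌋)))
      (trans (sym (∑-cong k (λ j → unless-∑ ⌊ a ≟ a' ⌋ k _))) (sym (unless-∑ ⌊ a ≟ a' ⌋ k _)))

across-∑ : ∀ {r k} (u v : Matrix r k) →
  across (λ j → ∑ r (λ a → u a j)) (λ j → ∑ r (λ a → v a j)) ≡ ∑ r (λ a → ∑ r (λ a' → across (u a) (v a')))
across-∑ {r} {k} u v = begin
  ∑ k (λ j → ∑ k (λ j' → unless ⌊ j ≟ j' ⌋ (∑ r (λ a → u a j) * ∑ r (λ a' → v a' j'))))
    ≡⟨ ∑-cong k (λ j → ∑-cong k (λ j' → trans (cong (unless ⌊ j ≟ j' ⌋) (expand j j'))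
         (trans (unless-∑ ⌊ j ≟ j' ⌋ r _) (∑-cong r (λ a → unless-∑ ⌊ j ≟ j' ⌋ r _))))) ⟩
  ∑ k (λ j → ∑ k (λ j' → ∑ r (λ a → ∑ r (λ a' → E j j' a a'))))
    ≡⟨ trans (∑-cong k (λ j → ∑-swap k r _)) (∑-swap k r _) ⟩
  ∑ r (λ a → ∑ k (λ j → ∑ k (λ j' → ∑ r (λ a' → E j j' a a'))))
    ≡⟨ ∑-cong r (λ a → trans (∑-cong k (λ j → ∑-swap k r _)) (∑-swap k r _)) ⟩
  ∑ r (λ a → ∑ r (λ a' → across (u a) (v a'))) ∎
  where
  open ≡-Reasoning
  E : Fin k → Fin k → Fin r → Fin r → ℕ
  E j j' a a' = unless ⌊ j ≟ j' ⌋ (u a j * v a' j')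
  expand : ∀ j j' → ∑ r (λ a → u a j) * ∑ r (λ a' → v a' j') ≡ ∑ r (λ a → ∑ r (λ a' → u a j * v a' j'))
  expand j j' = trans (sym (∑-*ʳ r _ (λ a → u a j))) (∑-cong r (λ a → sym (∑-*ˡ r (u a j) (λ a' → v a' j'))))

across-concentrate : ∀ {k} (q : Fin k) m → across (concentrate q m) (concentrate q m) ≡ 0
across-concentrate {k} q m = ∑-zero k (λ j → ∑-zero k (λ j' → term j j'))
  where
  term : ∀ j j' → unless ⌊ j ≟ j' ⌋ (concentrate q m j * concentrate q m j') ≡ 0
  term j j' with q ≟ j | q ≟ j'
  ... | yes refl | yes refl = unless-yes (q ≟ q) refl
  ... | yes _ | no _ = trans (cong (unless ⌊ j ≟ j' ⌋) (*-zeroʳ m)) (unless-zero ⌊ j ≟ j' ⌋)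
  ... | no _ | _ = unless-zero ⌊ j ≟ j' ⌋

∑∑-offDiagonal : ∀ r (F : Fin r → Fin r → ℕ) →
  ∑ r (λ a → ∑ r (λ a' → F a a')) ≡ ∑ r (λ a → ∑ r (λ a' → unless ⌊ a ≟ a' ⌋ (F a a'))) + ∑ r (λ a → F a a)
∑∑-offDiagonal r F = trans (∑-cong r (λ a → trans (∑-split r a (F a)) (trans (+-comm (F a a) _)
  (cong (_+ F a a) (∑-cong r (λ a' → cong (λ b → unless b (F a a')) (≟-sym a' a))))))) (∑-+ r _ _)

pairValue≡crossWeight : ∀ {r k} (n : Fin r → ℕ) (Q : Fin r → Fin k) →
  2 * pairValue n Q ≡ crossWeight (integralMatrix n Q)
pairValue≡crossWeight {r} {k} n Q = begin
  2 * pairValue n Q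
    ≡⟨ cong (2 *_) (∑-cong k (λ j → ∑-cong k (λ j' → orderedPair j j'))) ⟩
  2 * ∑ k (λ j → ∑ k (λ j' → onlyIf ⌊ j <? j' ⌋ (G j j')))
    ≡⟨ sym (∑∑-symmetric k G (λ j j' → cong₂ unless (≟-sym j j') (*-comm (A j) (A j')))
                             (λ j → cong (λ b → unless b (A j * A j)) (≟-refl j))) ⟩
  across A A
    ≡⟨ across-∑ (integralMatrix n Q) (integralMatrix n Q) ⟩
  ∑ r (λ a → ∑ r (λ a' → across (integralMatrix n Q a) (integralMatrix n Q a')))
    ≡⟨ ∑∑-offDiagonal r (λ a a' → across (integralMatrix n Q a) (integralMatrix n Q a')) ⟩
  crossWeight (integralMatrix n Q) + ∑ r (λ a → across (integralMatrix n Q a) (integralMatrix n Q a))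
    ≡⟨ cong (crossWeight (integralMatrix n Q) +_) (∑-zero r (λ a → across-concentrate (Q a) (n a))) ⟩
  crossWeight (integralMatrix n Q) + 0
    ≡⟨ +-identityʳ _ ⟩
  crossWeight (integralMatrix n Q) ∎
  where
  open ≡-Reasoning
  A : Fin k → ℕ
  A = partSize n Q
  G : Fin k → Fin k → ℕ
  G j j' = unless ⌊ j ≟ j' ⌋ (A j * A j')
  orderedPair : ∀ j j' → (if ⌊ j <? j' ⌋ then A j * A j' else 0) ≡ onlyIf ⌊ j <? j' ⌋ (G j j')
  orderedPair j j' with j <? j'
  ... | yes j<j' = sym (unless-no (j ≟ j') (<ᶠ⇒≢ j<j'))
  ... | no _ = refl

-- Partitions through their intersection matrices

onlyIf-×-dec : ∀ {p q} {A : Set p} {A' : Set q} (d : Dec A) (d' : Dec A') y →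
  onlyIf ⌊ d ×-dec d' ⌋ y ≡ onlyIf ⌊ d ⌋ (onlyIf ⌊ d' ⌋ y)
onlyIf-×-dec (yes _) (yes _) y = refl
onlyIf-×-dec (yes _) (no _) y = refl
onlyIf-×-dec (no _) d' y = refl

module Dictionary {N r k : ℕ} (n : Fin r → ℕ) (c : Fin N → Fin r)
                  (sizes : ∀ i → count (λ x → c x ≟ i) ≡ n i) (P : Fin N → Fin k) where
  open Intersection c P public
  open PartialStructure n intersection public

  count-inColumn : ∀ j {A : Fin r → Set} (A? : ∀ i → Dec (A i)) →
    count (λ x → (P x ≟ j) ×-dec A? (c x)) ≡ ∑ r (λ i → onlyIf ⌊ A? i ⌋ (intersection i j))
  count-inColumn j A? = trans (count-byCells (λ i j' → (j' ≟ j) ×-dec A? i))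
    (∑-cong r (λ i → trans (∑-cong k (λ j' → onlyIf-×-dec (j' ≟ j) (A? i) _))
                           (∑-onlyIf≟ k j (λ j' → onlyIf ⌊ A? i ⌋ (intersection i j')))))

  rowSums : HasRowSums n intersection
  rowSums i = trans (sym (trans (count-byCells (λ i' _ → i' ≟ i)) (trans
    (∑-cong r (λ i' → sym (onlyIf-∑ ⌊ i' ≟ i ⌋ k (intersection i'))))
    (∑-onlyIf≟ r i (λ i' → ∑ k (intersection i'))))))
    (sizes i)

  private
    indicator-positive : ∀ i j x → c x ≡ i → P x ≡ j → 1 ≤ indicator x i j
    indicator-positive i j x cx≡i Px≡j with c x ≟ i | P x ≟ j
    ... | yes _ | yes _ = s≤s z≤n
    ... | no ≢ | _ = ⊥-elim (≢ cx≡i)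
    ... | yes _ | no ≢ = ⊥-elim (≢ Px≡j)

  meets⇒positive : ∀ i j → Meets c P i j → 1 ≤ intersection i j
  meets⇒positive i j (x , cx≡i , Px≡j) = ≤-trans (indicator-positive i j x cx≡i Px≡j)
    (term≤∑ N (λ y → indicator y i j) x)

  positive⇒meets : ∀ i j → 1 ≤ intersection i j → Meets c P i j
  positive⇒meets i j pos with ∑-positive N (λ x → indicator x i j) pos
  ... | x , p with (c x ≟ i) ×-dec (P x ≟ j)
  ...   | yes (cx≡i , Px≡j) = x , cx≡i , Px≡j
  ...   | no _ = ⊥-elim (1+n≰n (≤-trans p z≤n))

  integral⇒full : ∀ i j → Integral c P i j → intersection i j ≡ n i
  integral⇒full i j integral = trans (∑-cong N inClass) (sizes i)
    where
    inClass : ∀ x → indicator x i j ≡ onlyIf ⌊ c x ≟ i ⌋ 1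
    inClass x with c x ≟ i | P x ≟ j
    ... | no _ | _ = refl
    ... | yes _ | yes _ = refl
    ... | yes cx≡i | no ≢ = ⊥-elim (≢ (integral x cx≡i))

  full⇒integral : ∀ i j → intersection i j ≡ n i → Integral c P i j
  full⇒integral i j full x cx≡i with P x ≟ j
  ... | yes Px≡j = Px≡j
  ... | no Px≢j = ⊥-elim (1+n≰n (≤-trans (meets⇒positive i (P x) (x , cx≡i , refl))
                                          (≤-reflexive (full⇒zeroElsewhere rowSums i j full (P x) Px≢j))))

  partialIn⇒partialEntry : ∀ i j → PartialIn c P i j → PartialEntry i j
  partialIn⇒partialEntry i j (meets , ¬integral) = meets⇒positive i j meets , λ full → ¬integral (full⇒integral i j full)

  partialEntry⇒partialIn : ∀ i j → PartialEntry i j → PartialIn c P i j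
  partialEntry⇒partialIn i j (pos , ¬full) = positive⇒meets i j pos , λ integral → ¬full (integral⇒full i j integral)

  intSize≡integralMass : ∀ j → intSize c P j ≡ integralMass j
  intSize≡integralMass j = trans (count-inColumn j (λ i → integral? c P i j)) (∑-cong r entry)
    where
    entry : ∀ i → onlyIf ⌊ integral? c P i j ⌋ (intersection i j)
                ≡ onlyIf ⌊ intersection i j ℕ.≟ n i ⌋ (intersection i j)
    entry i with integral? c P i j | intersection i j ℕ.≟ n i
    ... | yes _ | yes _ = refl
    ... | no _ | no _ = refl
    ... | yes integral | no ¬full = ⊥-elim (¬full (integral⇒full i j integral))
    ... | no ¬integral | yes full = ⊥-elim (¬integral (full⇒integral i j full))

  classSize≡column : ∀ j → classSize c P j ≡ column intersection j
  classSize≡column j = trans (count-byCells (λ _ j' → j' ≟ j))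
    (∑-cong r (λ i → ∑-onlyIf≟ k j (intersection i)))

  diffSize≡columnExcept : ∀ j i → diffSize c P j i ≡ columnExcept intersection i j
  diffSize≡columnExcept j i = trans (count-inColumn j (λ i' → ¬? (i' ≟ i))) (∑-cong r entry)
    where
    entry : ∀ i' → onlyIf ⌊ ¬? (i' ≟ i) ⌋ (intersection i' j) ≡ unless ⌊ i' ≟ i ⌋ (intersection i' j)
    entry i' with i' ≟ i
    ... | yes _ = refl
    ... | no _ = refl

  private
    module Q-Intersection (Q : Fin N → Fin k) = Intersection c Q

  row-kept : ∀ Q i → (∀ x → c x ≡ i → Q x ≡ P x) → ∀ j → Q-Intersection.intersection Q i j ≡ intersection i j
  row-kept Q i kept j = ∑-cong N entry
    where
    entry : ∀ x → Q-Intersection.indicator Q x i j ≡ indicator x i j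
    entry x with c x ≟ i
    ... | no _ = refl
    ... | yes cx≡i rewrite kept x cx≡i = refl

  row-moved : ∀ Q i g → (∀ x → c x ≡ i → Q x ≡ g) → ∀ j → Q-Intersection.intersection Q i j ≡ concentrate g (n i) j
  row-moved Q i g moved j = begin
    ∑ N (λ x → Q-Intersection.indicator Q x i j)          ≡⟨ ∑-cong N entry ⟩
    ∑ N (λ x → onlyIf ⌊ g ≟ j ⌋ (onlyIf ⌊ c x ≟ i ⌋ 1))   ≡⟨ sym (onlyIf-∑ ⌊ g ≟ j ⌋ N _) ⟩
    onlyIf ⌊ g ≟ j ⌋ (count (λ x → c x ≟ i))              ≡⟨ cong (onlyIf ⌊ g ≟ j ⌋) (sizes i) ⟩
    concentrate g (n i) j                                 ∎
    where
    open ≡-Reasoning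
    entry : ∀ x → Q-Intersection.indicator Q x i j ≡ onlyIf ⌊ g ≟ j ⌋ (onlyIf ⌊ c x ≟ i ⌋ 1)
    entry x with c x ≟ i
    ... | no _ = sym (onlyIf-zero _)
    ... | yes cx≡i rewrite moved x cx≡i = onlyIf-×-dec (yes cx≡i) (g ≟ j) 1

  partialV? : ∀ i → Dec (PartialV c P i)
  partialV? i = any? (λ j → any? (λ x → (c x ≟ i) ×-dec (P x ≟ j)) ×-dec ¬? (integral? c P i j))

  internalisedRows : ∀ Q → IsInternalization c P Q →
    ∀ i → Internalisation.InternalisedRow n intersection (Q-Intersection.intersection Q) rowSums i
  internalisedRows Q (g , meets , moved) i with partialV? i
  ... | yes (j₀ , partial) = inj₂ ((j₀ , partialIn⇒partialEntry i j₀ partial) , g i ,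
        meets⇒positive i (g i) (meets i (j₀ , partial)) ,
        row-moved Q i (g i) (λ { x refl → proj₁ (moved x) (j₀ , partial) }))
  ... | no ¬partial = inj₁ (row-kept Q i (λ { x refl → proj₂ (moved x) ¬partial }))

-- Extremal partitions

module Extremality {N r k : ℕ} (n : Fin r → ℕ) (c : Fin N → Fin r)
                   (sizes : ∀ i → count (λ x → c x ≟ i) ≡ n i) (P : Fin N → Fin k) where
  open Dictionary n c sizes P

  private
    module Q-Intersection (Q : Fin N → Fin k) = Intersection c Q

  sameCrossWeight⇒sameEdges : ∀ Q → crossWeight (Q-Intersection.intersection Q) ≡ crossWeight intersection →
    edgesP c Q ≡ edgesP c P
  sameCrossWeight⇒sameEdges Q same =
    *-cancelˡ-≡ _ _ 2 (trans (Q-Intersection.edges≡crossWeight Q) (trans same (sym edges≡crossWeight)))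

  extremal⇒maximiser : Fin k → Extremal n c P → IsMaximiser n intersection
  extremal⇒maximiser g₀ (_ , maximal) = rowSums , roundingBound n g₀ (crossWeight intersection) integral≤
    where
    integral≤ : ∀ Q → crossWeight (integralMatrix n Q) ≤ crossWeight intersection
    integral≤ Q = ≤-trans (≤-reflexive (sym (pairValue≡crossWeight n Q)))
                          (≤-trans (*-monoʳ-≤ 2 (maximal Q)) (≤-reflexive edges≡crossWeight))

  maximiser⇒stable : (∀ i → 1 ≤ n i) → k < r → IsMaximiser n intersection → Stable c P n
  maximiser⇒stable pos k<r mx =
      (λ j i i' p p' → onePartial j i i' (partial i j p) (partial i' j p'))
    , (λ j j' (i , p) (i' , p') → begin-equality
         intSize c P j   ≡⟨ intSize≡integralMass j ⟩
         integralMass j  ≡⟨ integralMass-equal i i' j j' (partial i j p) (partial i' j' p') ⟩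
         integralMass j' ≡⟨ intSize≡integralMass j' ⟨
         intSize c P j'  ∎)
    , (λ j j' (i , p) _ → begin
         intSize c P j            ≡⟨ intSize≡integralMass j ⟩
         integralMass j           ≤⟨ integralMass≤column i j j' (partial i j p) ⟩
         column intersection j'   ≡⟨ classSize≡column j' ⟨
         classSize c P j'         ∎)
    , (λ j i (l , p) → begin
         n i            ≤⟨ partialRow≤integralMass-any pos k<r j i l (partial i l p) ⟩
         integralMass j ≡⟨ intSize≡integralMass j ⟨
         intSize c P j  ∎)
    , (λ j i integral j' j≢j' → begin
         diffSize c P j i              ≡⟨ diffSize≡columnExcept j i ⟩
         columnExcept intersection i j ≤⟨ integralRow-columnExcept≤ pos k<r j i (integral⇒full i j integral) j' j≢j' ⟩
         integralMass j'               ≡⟨ intSize≡integralMass j' ⟨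
         intSize c P j'                ∎)
    where
    open MaximiserStructure n intersection mx
    open ≤-Reasoning
    partial = partialIn⇒partialEntry

  maximiser⇒internalisation-sameEdges : IsMaximiser n intersection →
    ∀ Q → IsInternalization c P Q → edgesP c Q ≡ edgesP c P
  maximiser⇒internalisation-sameEdges mx Q internal =
    sameCrossWeight⇒sameEdges Q (maximiser-internalisation (internalisedRows Q internal) mx)
    where open Internalisation n intersection (Q-Intersection.intersection Q) rowSums

  stable⇒internalisation-sameEdges : Stable c P n → ∀ Q → IsInternalization c P Q → edgesP c Q ≡ edgesP c P
  stable⇒internalisation-sameEdges (onePartialIn , equalIntSizes , _) Q internal =
    sameCrossWeight⇒sameEdges Q (stable-internalisation (internalisedRows Q internal) one equal)
    where
    open Internalisation n intersection (Q-Intersection.intersection Q) rowSums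
    one : OnePartialPerColumn
    one j i i' p p' = onePartialIn j i i' (partialEntry⇒partialIn i j p) (partialEntry⇒partialIn i' j p')
    equal : EqualIntegralMasses
    equal i i' j j' p p' = trans (sym (intSize≡integralMass j))
      (trans (equalIntSizes j j' (i , partialEntry⇒partialIn i j p) (i' , partialEntry⇒partialIn i' j' p'))
             (intSize≡integralMass j'))

  canonicalInternalisation : (∀ i → 1 ≤ n i) → ∃ λ Q → IsInternalization c P Q
  canonicalInternalisation pos =
    (λ x → g (c x)) , g , (λ i _ → vertex i , vertex-in i , refl) , λ x → (λ _ → refl) , kept x
    where
    member : ∀ i → ∃ λ x → c x ≡ i
    member i with ∑-positive N (λ x → onlyIf ⌊ c x ≟ i ⌋ 1) (subst (1 ≤_) (sym (sizes i)) (pos i))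
    ... | x , p with c x ≟ i
    ...   | yes cx≡i = x , cx≡i
    ...   | no _ = ⊥-elim (1+n≰n (≤-trans p z≤n))
    vertex : Fin r → Fin N
    vertex i = proj₁ (member i)
    vertex-in : ∀ i → c (vertex i) ≡ i
    vertex-in i = proj₂ (member i)
    g : Fin r → Fin k
    g i = P (vertex i)
    kept : ∀ x → ¬ PartialV c P (c x) → g (c x) ≡ P x
    kept x ¬partial with integral? c P (c x) (g (c x))
    ... | yes integral = sym (integral x refl)
    ... | no ¬integral = ⊥-elim (¬partial (g (c x) , (vertex (c x) , vertex-in (c x) , refl) , ¬integral))

theorem1p2 : (r t : ℕ) → 3 ≤ t → t ≤ r →
    (n : Fin r → ℕ) →
    ((i j : Fin r) → i ≤ᶠ j → n j ≤ n i) →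
    ((i : Fin r) → 1 ≤ n i) →
    (N : ℕ) (c : Fin N → Fin r) →
    ((i : Fin r) → count (λ x → c x ≟ i) ≡ n i) →
    (P : Fin N → Fin (t ∸ 1)) →
    Extremal n c P ⇔
      (Stable c P n × ((Q : Fin N → Fin (t ∸ 1)) → IsInternalization c P Q → Extremal n c Q))
theorem1p2 r (suc (suc (suc t))) (s≤s (s≤s (s≤s _))) k<r n _ pos N c sizes P = mk⇔ forward backward
  where
  open Extremality n c sizes P

  forward : Extremal n c P → Stable c P n × (∀ Q → IsInternalization c P Q → Extremal n c Q)
  forward extremal = maximiser⇒stable pos k<r mx , λ Q internal →
      subst (IsF r (suc (suc t)) n) (sym (maximiser⇒internalisation-sameEdges mx Q internal)) extremal
    where mx = extremal⇒maximiser zero extremal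

  backward : Stable c P n × (∀ Q → IsInternalization c P Q → Extremal n c Q) → Extremal n c P
  backward (stable , internalisedExtremal) =
    subst (IsF r (suc (suc t)) n) (stable⇒internalisation-sameEdges stable Q internal) (internalisedExtremal Q internal)
    where
    Q = proj₁ (canonicalInternalisation pos)
    internal = proj₂ (canonicalInternalisation pos)
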